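{- If $\Gamma$ is a simple undirected graph containing $e\ge1$ undirected edges, then the cubic graph resulting from applying the Quick HCP to 3HCP Conversion Procedure to $\Gamma$ (each undirected edge regarded as two opposite arcs) contains no more than $100e$ vertices and $150e$ edges.
   Context: An undirected edge $\{u,v\}$ is regarded as the pair of arcs $(u,v),(v,u)$. A split replaces a vertex $w$ by $p,q$ with arc $(p,q)$; arcs into $w$ go into $p$, arcs out of $w$ leave from $q$. An in-split replaces $w$ by $p,q,t$ with arcs $(p,q),(q,p),(p,t),(q,t)$; arcs into $w$ are divided between $p$ and $q$ (numbers differing by at most one); arcs out of $w$ leave from $t$. An out-split replaces $w$ by $p,q,t$ with arcs $(p,q),(p,t),(q,t),(t,q)$; arcs into $w$ go into $p$; arcs out of $w$ are divided between $q$ and $t$ (numbers differing by at most one). The Splitting Procedure for a vertex $v$ with parameter $d$: replace $v$ by a split; then while some vertex of the replacing subgraph has in-degree $>d$ replace it by an in-split; then while some vertex of the replacing subgraph has out-degree $>d$ replace it by an out-split. The 4-gate is the undirected graph on $\{1,\dots,11\}$ with edges $\{1,3\},\{1,8\},\{2,3\},\{2,5\},\{3,4\},\{4,5\},\{4,6\},\{6,7\},\{7,8\},\{7,10\},\{8,9\},\{9,10\},\{10,11\},\{5,11\}$ and attachment vertices $1,2,9,11$. Quick HCP to 3HCP Conversion Procedure: (1) perform the Splitting Procedure with $d=3$ on every vertex with in-degree or out-degree greater than 3; (2) convert to an undirected graph by replacing each vertex $v$ by $a_v,b_v,c_v$ with edges $\{a_v,b_v\},\{b_v,c_v\}$ and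 adding $\{c_u,a_v\}$ for each arc $(u,v)$; (3) replace each degree-4 vertex by a copy of the 4-gate, joining its four former neighbours bijectively to the attachment vertices; (4) if some vertex has degree 1, output the Petersen graph; otherwise replace each degree-2 vertex with neighbours $u,w$ by a diamond: new vertices $x,y,z,t$ with edges $\{x,y\},\{x,z\},\{y,z\},\{y,t\},\{z,t\},\{u,x\},\{t,w\}$. -}

module Defs where

open import Data.Nat using (ℕ; zero; suc; _+_; _*_; _≤_; _<_; _≡ᵇ_)
open import Data.Bool using (Bool; true; false; if_then_else_; _∨_; not)
open import Data.Product using (_×_; _,_; proj₁; proj₂; Σ; ∃; ∃-syntax)
open import Data.Sum using (_⊎_)
open import Data.List using (List; []; _∷_; _++_; length; map; concatMap; filterᵇ; zipWith; zip)
open import Data.List.Membership.Propositional using (_∈_; _∉_)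
open import Data.List.Relation.Unary.All using (All)
open import Data.List.Relation.Unary.AllPairs using (AllPairs)
open import Data.List.Relation.Unary.Unique.Propositional using (Unique)
open import Data.List.Relation.Binary.Permutation.Propositional using (_↭_)
open import Data.Vec using (Vec; toList; lookup)
open import Data.Fin using (Fin; #_)
open import Relation.Binary.PropositionalEquality using (_≡_; _≢_)
open import Relation.Nullary using (¬_)

-- An undirected edge {u,v} is stored as an ordered pair (u , v) in
-- either order.

record DiGraph : Set where
  constructor mkDi
  field
    verts : List ℕ
    arcs  : List (ℕ × ℕ)
open DiGraph public

record UGraph : Set where
  constructor mkU
  field
    uverts : List ℕ
    uedges : List (ℕ × ℕ)
open UGraph public

remove : ℕ → List ℕ → List ℕ
remove w = filterᵇ (λ x → not (x ≡ᵇ w))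

indeg : DiGraph → ℕ → ℕ
indeg G v = length (filterᵇ (λ a → proj₂ a ≡ᵇ v) (arcs G))

outdeg : DiGraph → ℕ → ℕ
outdeg G v = length (filterᵇ (λ a → proj₁ a ≡ᵇ v) (arcs G))

-- undirected degree (a loop would count twice)
incident : ℕ → ℕ × ℕ → Bool
incident w (x , y) = (x ≡ᵇ w) ∨ (y ≡ᵇ w)

deg : UGraph → ℕ → ℕ
deg U v = length (filterᵇ (λ e → proj₁ e ≡ᵇ v) (uedges U))
        + length (filterᵇ (λ e → proj₂ e ≡ᵇ v) (uedges U))

other : ℕ → ℕ × ℕ → ℕ
other w (x , y) = if x ≡ᵇ w then y else x

nbrs : UGraph → ℕ → List ℕ
nbrs U w = map (other w) (filterᵇ (incident w) (uedges U))

nonIncident : UGraph → ℕ → List (ℕ × ℕ)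
nonIncident U w = filterᵇ (λ e → not (incident w e)) (uedges U)

Fresh : List ℕ → List ℕ → Set
Fresh used new = Unique new × All (λ x → x ∉ used) new

-- Runs of a nondeterministic "while" loop: repeatedly apply a step
-- relation R until the stopping condition `done` holds.

data Run {A : Set} (R : A → A → Set) (done : A → Set) : A → A → Set where
  stop : ∀ {x} → done x → Run R done x x
  next : ∀ {x y z} → R x y → Run R done y z → Run R done x z

splitArc : ℕ → ℕ → ℕ → ℕ × ℕ → ℕ × ℕ
splitArc w p q (x , y) = (if x ≡ᵇ w then q else x) , (if y ≡ᵇ w then p else y)

splitG : DiGraph → ℕ → ℕ → ℕ → DiGraph
splitG G w p q =
  mkDi (remove w (verts G) ++ p ∷ q ∷ [])
       (map (splitArc w p q) (arcs G) ++ (p , q) ∷ [])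

-- in-split: the Bool attached to an arc says whether (if it enters w) it
-- is redirected to p (true) or to q (false)
inArc : ℕ → ℕ → ℕ → ℕ → Bool → ℕ × ℕ → ℕ × ℕ
inArc w p q t b (x , y) =
  (if x ≡ᵇ w then t else x) , (if y ≡ᵇ w then (if b then p else q) else y)

inSplitArcs : DiGraph → ℕ → ℕ → ℕ → ℕ → List Bool → List (ℕ × ℕ)
inSplitArcs G w p q t bs = zipWith (inArc w p q t) bs (arcs G)

inSplitG : DiGraph → ℕ → ℕ → ℕ → ℕ → List Bool → DiGraph
inSplitG G w p q t bs =
  mkDi (remove w (verts G) ++ p ∷ q ∷ t ∷ [])
       (inSplitArcs G w p q t bs ++ (p , q) ∷ (q , p) ∷ (p , t) ∷ (q , t) ∷ [])

-- out-split: the Bool says whether an arc leaving w leaves from q (true)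
-- or from t (false)
outArc : ℕ → ℕ → ℕ → ℕ → Bool → ℕ × ℕ → ℕ × ℕ
outArc w p q t b (x , y) =
  (if x ≡ᵇ w then (if b then q else t) else x) , (if y ≡ᵇ w then p else y)

outSplitArcs : DiGraph → ℕ → ℕ → ℕ → ℕ → List Bool → List (ℕ × ℕ)
outSplitArcs G w p q t bs = zipWith (outArc w p q t) bs (arcs G)

outSplitG : DiGraph → ℕ → ℕ → ℕ → ℕ → List Bool → DiGraph
outSplitG G w p q t bs =
  mkDi (remove w (verts G) ++ p ∷ q ∷ t ∷ [])
       (outSplitArcs G w p q t bs ++ (p , q) ∷ (p , t) ∷ (q , t) ∷ (t , q) ∷ [])

Balanced : ℕ → ℕ → Set
Balanced m n = m ≤ suc n × n ≤ suc m

countTo : ℕ → List (ℕ × ℕ) → ℕ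
countTo v as = length (filterᵇ (λ a → proj₂ a ≡ᵇ v) as)

countFrom : ℕ → List (ℕ × ℕ) → ℕ
countFrom v as = length (filterᵇ (λ a → proj₁ a ≡ᵇ v) as)

-- State of the Splitting Procedure: current graph and the list of
-- vertices of the replacing subgraph.
SState : Set
SState = DiGraph × List ℕ

data InSplitStep (d : ℕ) : SState → SState → Set where
  inSplit : ∀ {G S} (w p q t : ℕ) (bs : List Bool) →
    w ∈ S → d < indeg G w →
    Fresh (verts G) (p ∷ q ∷ t ∷ []) →
    length bs ≡ length (arcs G) →
    Balanced (countTo p (inSplitArcs G w p q t bs))
             (countTo q (inSplitArcs G w p q t bs)) →
    InSplitStep d (G , S) (inSplitG G w p q t bs , remove w S ++ p ∷ q ∷ t ∷ [])

data OutSplitStep (d : ℕ) : SState → SState → Set where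
  outSplit : ∀ {G S} (w p q t : ℕ) (bs : List Bool) →
    w ∈ S → d < outdeg G w →
    Fresh (verts G) (p ∷ q ∷ t ∷ []) →
    length bs ≡ length (arcs G) →
    Balanced (countFrom q (outSplitArcs G w p q t bs))
             (countFrom t (outSplitArcs G w p q t bs)) →
    OutSplitStep d (G , S) (outSplitG G w p q t bs , remove w S ++ p ∷ q ∷ t ∷ [])

InDone : ℕ → SState → Set
InDone d (G , S) = All (λ v → indeg G v ≤ d) S

OutDone : ℕ → SState → Set
OutDone d (G , S) = All (λ v → outdeg G v ≤ d) S

data SplittingProcedure (d : ℕ) (G : DiGraph) (v : ℕ) (G' : DiGraph) : Set where
  splitting : ∀ (p q : ℕ) (s₁ s₂ : SState) →
    Fresh (verts G) (p ∷ q ∷ []) →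
    Run (InSplitStep d) (InDone d) (splitG G v p q , p ∷ q ∷ []) s₁ →
    Run (OutSplitStep d) (OutDone d) s₁ s₂ →
    proj₁ s₂ ≡ G' →
    SplittingProcedure d G v G'

data Step1 : DiGraph → DiGraph → Set where
  step1 : ∀ {G G'} (v : ℕ) → v ∈ verts G → (3 < indeg G v ⊎ 3 < outdeg G v) →
    SplittingProcedure 3 G v G' → Step1 G G'

Step1Done : DiGraph → Set
Step1Done G = All (λ v → indeg G v ≤ 3 × outdeg G v ≤ 3) (verts G)

aV bV cV : ℕ → ℕ
aV v = 3 * v
bV v = 3 * v + 1
cV v = 3 * v + 2

toUndirected : DiGraph → UGraph
toUndirected G =
  mkU (concatMap (λ v → aV v ∷ bV v ∷ cV v ∷ []) (verts G))
      (concatMap (λ v → (aV v , bV v) ∷ (bV v , cV v) ∷ []) (verts G)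
        ++ map (λ a → (cV (proj₁ a) , aV (proj₂ a))) (arcs G))

-- Step (3): the 4-gate.  Gate vertex i (1..11) is index # (i-1), label lookup g (# (i-1)).

gateEdgeIdx : List (Fin 11 × Fin 11)
gateEdgeIdx =
  (# 0 , # 2) ∷ (# 0 , # 7) ∷ (# 1 , # 2) ∷ (# 1 , # 4) ∷ (# 2 , # 3) ∷
  (# 3 , # 4) ∷ (# 3 , # 5) ∷ (# 5 , # 6) ∷ (# 6 , # 7) ∷ (# 6 , # 9) ∷
  (# 7 , # 8) ∷ (# 8 , # 9) ∷ (# 9 , # 10) ∷ (# 4 , # 10) ∷ []

gateEdges : Vec ℕ 11 → List (ℕ × ℕ)
gateEdges g = map (λ e → lookup g (proj₁ e) , lookup g (proj₂ e)) gateEdgeIdx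

-- attachment vertices 1,2,9,11
attachments : Vec ℕ 11 → List ℕ
attachments g =
  lookup g (# 0) ∷ lookup g (# 1) ∷ lookup g (# 8) ∷ lookup g (# 10) ∷ []

data GateStep : UGraph → UGraph → Set where
  gate : ∀ {U} (w : ℕ) (g : Vec ℕ 11) (σ : List ℕ) →
    w ∈ uverts U → deg U w ≡ 4 →
    Fresh (uverts U) (toList g) →
    σ ↭ attachments g →
    GateStep U (mkU (remove w (uverts U) ++ toList g)
                    (nonIncident U w ++ gateEdges g ++ zip (nbrs U w) σ))

Step3Done : UGraph → Set
Step3Done U = All (λ v → deg U v ≢ 4) (uverts U)

data DiamondStep : UGraph → UGraph → Set where
  diamond : ∀ {U} (v u w x y z t : ℕ) →
    v ∈ uverts U → deg U v ≡ 2 →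
    nbrs U v ↭ u ∷ w ∷ [] →
    Fresh (uverts U) (x ∷ y ∷ z ∷ t ∷ []) →
    DiamondStep U (mkU (remove v (uverts U) ++ x ∷ y ∷ z ∷ t ∷ [])
                       (nonIncident U v ++
                        (x , y) ∷ (x , z) ∷ (y , z) ∷ (y , t) ∷ (z , t) ∷
                        (u , x) ∷ (t , w) ∷ []))

Step4Done : UGraph → Set
Step4Done U = All (λ v → deg U v ≢ 2) (uverts U)

petersen : UGraph
petersen =
  mkU (0 ∷ 1 ∷ 2 ∷ 3 ∷ 4 ∷ 5 ∷ 6 ∷ 7 ∷ 8 ∷ 9 ∷ [])
      ((0 , 1) ∷ (1 , 2) ∷ (2 , 3) ∷ (3 , 4) ∷ (4 , 0) ∷
       (0 , 5) ∷ (1 , 6) ∷ (2 , 7) ∷ (3 , 8) ∷ (4 , 9) ∷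
       (5 , 7) ∷ (7 , 9) ∷ (9 , 6) ∷ (6 , 8) ∷ (8 , 5) ∷ [])

data Step4 : UGraph → UGraph → Set where
  toPetersen : ∀ {U} (v : ℕ) → v ∈ uverts U → deg U v ≡ 1 → Step4 U petersen
  toDiamonds : ∀ {U U'} → All (λ v → deg U v ≢ 1) (uverts U) →
    Run DiamondStep Step4Done U U' → Step4 U U'

SameEdge : ℕ × ℕ → ℕ × ℕ → Set
SameEdge (u , v) (x , y) = (u ≡ x × v ≡ y) ⊎ (u ≡ y × v ≡ x)

IsSimple : UGraph → Set
IsSimple Γ =
  Unique (uverts Γ) ×
  All (λ e → proj₁ e ∈ uverts Γ × proj₂ e ∈ uverts Γ × proj₁ e ≢ proj₂ e) (uedges Γ) ×
  AllPairs (λ e f → ¬ SameEdge e f) (uedges Γ)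

toDigraph : UGraph → DiGraph
toDigraph Γ = mkDi (uverts Γ) (concatMap (λ e → e ∷ (proj₂ e , proj₁ e) ∷ []) (uedges Γ))

data QuickConversion (Γ : UGraph) (C : UGraph) : Set where
  conv : ∀ (G₁ : DiGraph) (U₃ : UGraph) →
    Run Step1 Step1Done (toDigraph Γ) G₁ →
    Run GateStep Step3Done (toUndirected G₁) U₃ →
    Step4 U₃ C →
    QuickConversion Γ C

module Submission where

-- The proof is a potential argument.  A vertex of a digraph with in-degree i and
-- out-degree o costs `cost i o`, and Φ G is the total cost; a vertex of degree d
-- of an undirected graph weighs θ d (θ 2 = 4, θ 4 = 14, otherwise 1), and Θ U is
-- the total weight.  Then
--   * split, in-split and out-split are local replacements of one vertex by
--     vertices of no larger total cost, so step (1) does not increase Φ;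
--   * after step (1) all in- and out-degrees are at most 3, and the weight of
--     the undirected graph of step (2) equals Φ;
--   * a 4-gate weighs 14 = θ 4 and a diamond 4 = θ 2, so steps (3) and (4)
--     (both instances of one gadget-replacement lemma) do not increase Θ;
--   * every vertex weighs at least 1, hence |V(C)| ≤ Θ C ≤ Φ (toDigraph Γ);
--   * a non-isolated vertex costs at most 25 per incident arc and the input
--     digraph has 4e arcs in total, so Φ (toDigraph Γ) ≤ 100e.  An isolated
--     vertex would give a vertex of degree 1, i.e. the Petersen output.
-- Finally C is cubic, so 2|E(C)| = 3|V(C)| ≤ 300e.

open import Defs
open import Data.Nat using (ℕ; suc; _+_; _*_; _≤_; _<_; _≡ᵇ_; z≤n; s≤s; s≤s⁻¹)
open import Data.Nat.Properties
open import Data.Nat.DivMod using (_%_; m<n⇒m%n≡m; [m+kn]%n≡m%n)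
open import Data.Nat.Tactic.RingSolver using (solve-∀)
open import Data.Bool using (Bool; true; false; if_then_else_; not; T)
open import Data.Empty using (⊥-elim)
open import Data.Product using (_×_; _,_; proj₁; proj₂; ∃)
open import Data.Sum using (_⊎_; inj₁; inj₂)
open import Data.List using (List; []; _∷_; _++_; length; map; concatMap; filterᵇ; zipWith; zip)
open import Data.List.Properties using (length-map; map-tabulate)
import Data.List as List
open import Data.List.Membership.Propositional using (_∈_; _∉_; find)
open import Data.List.Membership.Propositional.Properties using (∈-++⁺ˡ; ∈-++⁺ʳ; ∈-++⁻; ∈-filter⁻; ∈-filter⁺; ∈-concatMap⁺; ∈-concatMap⁻)
open import Data.List.Relation.Unary.Any as Any using (here; there)
open import Data.List.Relation.Unary.All as All using (All; []; _∷_)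
open import Data.List.Relation.Unary.All.Properties using (++⁺; map⁺; concat⁺)
open import Data.List.Relation.Unary.AllPairs using ([]; _∷_)
open import Data.List.Relation.Unary.Unique.Propositional using (Unique)
import Data.List.Relation.Unary.Unique.Propositional.Properties as Unique
open import Data.List.Relation.Binary.Permutation.Propositional using (_↭_; ↭-sym)
import Data.List.Relation.Binary.Permutation.Propositional as ↭
open import Data.List.Relation.Binary.Permutation.Propositional.Properties using (↭-length; ∈-resp-↭)
open import Data.Vec using (Vec; toList; lookup; _∷_; [])
open import Data.Vec.Membership.Propositional using () renaming (_∈_ to _∈ᵥ_)
open import Data.Vec.Membership.Propositional.Properties using (∈-lookup; ∈-toList⁺)
open import Data.Fin using (Fin; #_; toℕ) renaming (zero to fz; suc to fs)
import Data.Fin.Properties as Fin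
open import Relation.Binary.PropositionalEquality
open import Relation.Nullary using (¬_; yes; no)
open import Relation.Nullary.Decidable using (dec-true; dec-false; T?)
open import Algebra.Properties.CommutativeSemigroup +-commutativeSemigroup using (interchange; x∙yz≈y∙xz)

χ : Bool → ℕ
χ true  = 1
χ false = 0

variable
  X Y Z : Set

sumBy : (X → ℕ) → List X → ℕ
sumBy f []       = 0
sumBy f (x ∷ xs) = f x + sumBy f xs

count≡sumBy : (p : X → Bool) (xs : List X) → length (filterᵇ p xs) ≡ sumBy (λ x → χ (p x)) xs
count≡sumBy p []       = refl
count≡sumBy p (x ∷ xs) with p x
... | true  = cong suc (count≡sumBy p xs)
... | false = count≡sumBy p xs

sumBy-const : (k : ℕ) (xs : List X) → sumBy (λ _ → k) xs ≡ k * length xs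
sumBy-const k []       = sym (*-zeroʳ k)
sumBy-const k (x ∷ xs) = trans (cong (k +_) (sumBy-const k xs)) (sym (*-suc k (length xs)))

length≡sumBy : (xs : List X) → length xs ≡ sumBy (λ _ → 1) xs
length≡sumBy xs = sym (trans (sumBy-const 1 xs) (*-identityˡ (length xs)))

sumBy-++ : (f : X → ℕ) (xs ys : List X) → sumBy f (xs ++ ys) ≡ sumBy f xs + sumBy f ys
sumBy-++ f []       ys = refl
sumBy-++ f (x ∷ xs) ys = trans (cong (f x +_) (sumBy-++ f xs ys)) (sym (+-assoc (f x) _ _))

sumBy-map : (f : Y → ℕ) (g : X → Y) (xs : List X) → sumBy f (map g xs) ≡ sumBy (λ x → f (g x)) xs
sumBy-map f g []       = refl
sumBy-map f g (x ∷ xs) = cong (f (g x) +_) (sumBy-map f g xs)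

sumBy-concatMap : (f : Y → ℕ) (g : X → List Y) (xs : List X) →
  sumBy f (concatMap g xs) ≡ sumBy (λ x → sumBy f (g x)) xs
sumBy-concatMap f g []       = refl
sumBy-concatMap f g (x ∷ xs) =
  trans (sumBy-++ f (g x) (concatMap g xs)) (cong (sumBy f (g x) +_) (sumBy-concatMap f g xs))

sumBy-congOn : (f g : X → ℕ) (xs : List X) → All (λ x → f x ≡ g x) xs → sumBy f xs ≡ sumBy g xs
sumBy-congOn f g []       []         = refl
sumBy-congOn f g (x ∷ xs) (e ∷ es) = cong₂ _+_ e (sumBy-congOn f g xs es)

sumBy-cong : (f g : X → ℕ) (xs : List X) → (∀ x → f x ≡ g x) → sumBy f xs ≡ sumBy g xs
sumBy-cong f g xs e = sumBy-congOn f g xs (All.universal e xs)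

sumBy-monoOn : (f g : X → ℕ) (xs : List X) → All (λ x → f x ≤ g x) xs → sumBy f xs ≤ sumBy g xs
sumBy-monoOn f g []       []         = z≤n
sumBy-monoOn f g (x ∷ xs) (e ∷ es) = +-mono-≤ e (sumBy-monoOn f g xs es)

sumBy-zero : (f : X → ℕ) (xs : List X) → All (λ x → f x ≡ 0) xs → sumBy f xs ≡ 0
sumBy-zero f xs es = trans (sumBy-congOn f (λ _ → 0) xs es) (sumBy-const 0 xs)

sumBy-+ : (f g : X → ℕ) (xs : List X) → sumBy (λ x → f x + g x) xs ≡ sumBy f xs + sumBy g xs
sumBy-+ f g []       = refl
sumBy-+ f g (x ∷ xs) = trans (cong (f x + g x +_) (sumBy-+ f g xs)) (interchange (f x) (g x) (sumBy f xs) (sumBy g xs))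

sumBy-* : (k : ℕ) (f : X → ℕ) (xs : List X) → sumBy (λ x → k * f x) xs ≡ k * sumBy f xs
sumBy-* k f []       = sym (*-zeroʳ k)
sumBy-* k f (x ∷ xs) = trans (cong (k * f x +_) (sumBy-* k f xs)) (sym (*-distribˡ-+ k (f x) (sumBy f xs)))

sumBy-swap : (g : Y → X → ℕ) (ys : List Y) (xs : List X) →
  sumBy (λ y → sumBy (g y) xs) ys ≡ sumBy (λ x → sumBy (λ y → g y x) ys) xs
sumBy-swap g []       xs = sym (sumBy-zero (λ _ → 0) xs (All.universal (λ _ → refl) xs))
sumBy-swap g (y ∷ ys) xs =
  trans (cong (sumBy (g y) xs +_) (sumBy-swap g ys xs)) (sym (sumBy-+ (g y) (λ x → sumBy (λ y → g y x) ys) xs))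

sumBy-↭ : (f : X → ℕ) {xs ys : List X} → xs ↭ ys → sumBy f xs ≡ sumBy f ys
sumBy-↭ f ↭.refl         = refl
sumBy-↭ f (↭.prep x p)   = cong (f x +_) (sumBy-↭ f p)
sumBy-↭ f (↭.swap x y p) = trans (cong (λ z → f x + (f y + z)) (sumBy-↭ f p)) (x∙yz≈y∙xz (f x) (f y) _)
sumBy-↭ f (↭.trans p q)  = trans (sumBy-↭ f p) (sumBy-↭ f q)

sumBy-partition : (f : X → ℕ) (p : X → Bool) (xs : List X) →
  sumBy f xs ≡ sumBy f (filterᵇ p xs) + sumBy f (filterᵇ (λ x → not (p x)) xs)
sumBy-partition f p []       = refl
sumBy-partition f p (x ∷ xs) with p x
... | true  = trans (cong (f x +_) (sumBy-partition f p xs)) (sym (+-assoc (f x) _ _))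
... | false = trans (cong (f x +_) (sumBy-partition f p xs))
                    (x∙yz≈y∙xz (f x) (sumBy f (filterᵇ p xs)) (sumBy f (filterᵇ (λ x → not (p x)) xs)))

sumBy-zip : (f : X → ℕ) (g : Y → ℕ) (xs : List X) (ys : List Y) → length xs ≡ length ys →
  sumBy (λ e → f (proj₁ e) + g (proj₂ e)) (zip xs ys) ≡ sumBy f xs + sumBy g ys
sumBy-zip f g []       []       _ = refl
sumBy-zip f g (x ∷ xs) (y ∷ ys) l =
  trans (cong (f x + g y +_) (sumBy-zip f g xs ys (suc-injective l))) (interchange (f x) (g y) (sumBy f xs) (sumBy g ys))

sumBy-zipWith : (g : Z → ℕ) (h : Y → X → Z) (k : X → ℕ) (bs : List Y) (xs : List X) →
  length bs ≡ length xs → All (λ x → ∀ b → g (h b x) ≡ k x) xs → sumBy g (zipWith h bs xs) ≡ sumBy k xs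
sumBy-zipWith g h k []       []       _ []       = refl
sumBy-zipWith g h k (b ∷ bs) (x ∷ xs) l (e ∷ es) = cong₂ _+_ (e b) (sumBy-zipWith g h k bs xs (suc-injective l) es)

δ : ℕ → ℕ → ℕ
δ x y = χ (x ≡ᵇ y)

≡ᵇ-refl : ∀ x → (x ≡ᵇ x) ≡ true
≡ᵇ-refl x = dec-true (x ≟ x) refl

≡ᵇ-≢ : ∀ {x y} → x ≢ y → (x ≡ᵇ y) ≡ false
≡ᵇ-≢ {x} {y} = dec-false (x ≟ y)

δ-refl : ∀ x → δ x x ≡ 1
δ-refl x = cong χ (≡ᵇ-refl x)

δ-≢ : ∀ {x y} → x ≢ y → δ x y ≡ 0
δ-≢ ne = cong χ (≡ᵇ-≢ ne)

δ-sym : ∀ x y → δ x y ≡ δ y x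
δ-sym x y with x ≟ y
... | yes refl = refl
... | no ne    = trans (δ-≢ ne) (sym (δ-≢ (λ e → ne (sym e))))

T-not-≡ᵇ : ∀ {x w} → T (not (x ≡ᵇ w)) → x ≢ w
T-not-≡ᵇ {x} t refl rewrite ≡ᵇ-refl x = t

≢→T-not-≡ᵇ : ∀ {x w} → x ≢ w → T (not (x ≡ᵇ w))
≢→T-not-≡ᵇ ne rewrite ≡ᵇ-≢ ne = _

∈-remove⁻ : ∀ {w y} (xs : List ℕ) → y ∈ remove w xs → y ∈ xs × y ≢ w
∈-remove⁻ {w} xs m = let m′ , t = ∈-filter⁻ (λ x → T? (not (x ≡ᵇ w))) {xs = xs} m in m′ , T-not-≡ᵇ t

∈-remove⁺ : ∀ {w y} (xs : List ℕ) → y ∈ xs → y ≢ w → y ∈ remove w xs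
∈-remove⁺ {w} xs m ne = ∈-filter⁺ (λ x → T? (not (x ≡ᵇ w))) {xs = xs} m (≢→T-not-≡ᵇ ne)

remove-∉ : ∀ {w} (xs : List ℕ) → All (λ x → w ≢ x) xs → remove w xs ≡ xs
remove-∉ []       []           = refl
remove-∉ {w} (x ∷ xs) (w≢x ∷ ws) rewrite ≡ᵇ-≢ {x} {w} (λ e → w≢x (sym e)) = cong (x ∷_) (remove-∉ xs ws)

sumBy-remove : (f : ℕ → ℕ) {w : ℕ} (xs : List ℕ) → Unique xs → w ∈ xs → sumBy f xs ≡ f w + sumBy f (remove w xs)
sumBy-remove f (x ∷ xs) (x∉ ∷ _) (here refl) rewrite ≡ᵇ-refl x | remove-∉ xs x∉ = refl
sumBy-remove f {w} (x ∷ xs) (x∉ ∷ u) (there m) rewrite ≡ᵇ-≢ {x} {w} (All.lookup x∉ m) =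
  trans (cong (f x +_) (sumBy-remove f xs u m)) (x∙yz≈y∙xz (f x) (f w) _)

-- The vertex list obtained from V by replacing w by the new vertices N;
-- this is the vertex list produced by every local operation of the procedure.
replaceVertex : ℕ → List ℕ → List ℕ → List ℕ
replaceVertex w V N = remove w V ++ N

module _ {w : ℕ} (V N : List ℕ) where

  ∈-replace-old : ∀ {y} → y ∈ V → y ≢ w → y ∈ replaceVertex w V N
  ∈-replace-old m ne = ∈-++⁺ˡ (∈-remove⁺ V m ne)

  ∈-replace-new : ∀ {y} → y ∈ N → y ∈ replaceVertex w V N
  ∈-replace-new = ∈-++⁺ʳ (remove w V)

  ∈-replace⁻ : ∀ {y} → y ∈ replaceVertex w V N → (y ∈ V × y ≢ w) ⊎ y ∈ N
  ∈-replace⁻ m with ∈-++⁻ (remove w V) m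
  ... | inj₁ m₁ = inj₁ (∈-remove⁻ V m₁)
  ... | inj₂ m₂ = inj₂ m₂

  replace-unique : Unique V → Fresh V N → Unique (replaceVertex w V N)
  replace-unique uV (uN , fN) =
    Unique.++⁺ (Unique.filter⁺ _ uV) uN (λ (m₁ , m₂) → All.lookup fN m₂ (proj₁ (∈-remove⁻ V m₁)))

  replace-potential : (f f′ : ℕ → ℕ) → Unique V → w ∈ V →
    (∀ y → y ∈ V → y ≢ w → f′ y ≡ f y) → sumBy f′ N ≤ f w →
    sumBy f′ (replaceVertex w V N) ≤ sumBy f V
  replace-potential f f′ u wV same new = begin
    sumBy f′ (remove w V ++ N)           ≡⟨ sumBy-++ f′ (remove w V) N ⟩
    sumBy f′ (remove w V) + sumBy f′ N   ≡⟨ cong (_+ sumBy f′ N) (sumBy-congOn f′ f (remove w V) old) ⟩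
    sumBy f (remove w V) + sumBy f′ N    ≤⟨ +-monoʳ-≤ (sumBy f (remove w V)) new ⟩
    sumBy f (remove w V) + f w           ≡⟨ +-comm _ (f w) ⟩
    f w + sumBy f (remove w V)           ≡⟨ sym (sumBy-remove f V u wV) ⟩
    sumBy f V                            ∎
    where
    open ≤-Reasoning
    old : All (λ y → f′ y ≡ f y) (remove w V)
    old = All.tabulate (λ m → let m′ , ne = ∈-remove⁻ V m in same _ m′ ne)

sumBy-δ-∉ : ∀ {y} (xs : List ℕ) → y ∉ xs → sumBy (λ x → δ x y) xs ≡ 0
sumBy-δ-∉ xs y∉ = sumBy-zero _ xs (All.tabulate (λ m → δ-≢ (λ e → y∉ (subst (_∈ xs) e m))))

sumBy-δ-∈ : ∀ {y} (xs : List ℕ) → Unique xs → y ∈ xs → sumBy (λ x → δ x y) xs ≡ 1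
sumBy-δ-∈ {y} xs u m rewrite sumBy-remove (λ x → δ x y) xs u m | δ-refl y =
  cong suc (sumBy-δ-∉ (remove y xs) (λ m′ → proj₂ (∈-remove⁻ xs m′) refl))

handshake : (f : X → ℕ) (V : List ℕ) (as : List X) → Unique V → All (λ a → f a ∈ V) as →
  sumBy (λ y → sumBy (λ a → δ (f a) y) as) V ≡ length as
handshake f V as u inV = begin
  sumBy (λ y → sumBy (λ a → δ (f a) y) as) V ≡⟨ sumBy-swap (λ y a → δ (f a) y) V as ⟩
  sumBy (λ a → sumBy (λ y → δ (f a) y) V) as ≡⟨ sumBy-congOn _ _ as (All.map once inV) ⟩
  sumBy (λ _ → 1) as                          ≡⟨ sym (length≡sumBy as) ⟩
  length as                                   ∎
  where
  open ≡-Reasoning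
  once : ∀ {a} → f a ∈ V → sumBy (λ y → δ (f a) y) V ≡ 1
  once {a} m = trans (sumBy-cong _ _ V (δ-sym (f a))) (sumBy-δ-∈ V u m)

inD outD : List (ℕ × ℕ) → ℕ → ℕ
inD  as y = sumBy (λ a → δ (proj₂ a) y) as
outD as y = sumBy (λ a → δ (proj₁ a) y) as

indeg≡inD : ∀ G y → indeg G y ≡ inD (arcs G) y
indeg≡inD G y = count≡sumBy (λ a → proj₂ a ≡ᵇ y) (arcs G)

outdeg≡outD : ∀ G y → outdeg G y ≡ outD (arcs G) y
outdeg≡outD G y = count≡sumBy (λ a → proj₁ a ≡ᵇ y) (arcs G)

Ends : List ℕ → List (ℕ × ℕ) → Set
Ends V as = All (λ a → proj₁ a ∈ V × proj₂ a ∈ V) as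

WellFormed : DiGraph → Set
WellFormed G = Unique (verts G) × Ends (verts G) (arcs G)

∈∉⇒≢ : ∀ {y p : ℕ} {V} → y ∈ V → p ∉ V → y ≢ p
∈∉⇒≢ m p∉ refl = p∉ m

-- Redirecting an endpoint: the arcs of a split graph are the old arcs with
-- every endpoint w moved to one of the new vertices.

redirect : ℕ → ℕ → ℕ → ℕ
redirect w r x = if x ≡ᵇ w then r else x

redirect-other : ∀ {w r z} x → z ≢ w → z ≢ r → δ (redirect w r x) z ≡ δ x z
redirect-other {w} {r} {z} x z≢w z≢r with x ≟ w
... | yes refl rewrite ≡ᵇ-refl x = trans (δ-≢ (λ e → z≢r (sym e))) (sym (δ-≢ (λ e → z≢w (sym e))))
... | no x≢w rewrite ≡ᵇ-≢ x≢w = refl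

redirect-target : ∀ {w r} x → r ≢ w → δ (redirect w r x) r ≡ δ x w + δ x r
redirect-target {w} {r} x r≢w with x ≟ w
... | yes refl rewrite ≡ᵇ-refl x | δ-refl r | δ-≢ (λ e → r≢w (sym e)) = refl
... | no x≢w rewrite ≡ᵇ-≢ x≢w = refl

redirect-pair : ∀ {w r s c} x → c ≡ r ⊎ c ≡ s → r ≢ w → s ≢ w → r ≢ s →
  δ (redirect w c x) r + δ (redirect w c x) s ≡ δ x w + (δ x r + δ x s)
redirect-pair x (inj₁ refl) r≢w s≢w r≢s
  rewrite redirect-target x r≢w | redirect-other x s≢w (λ e → r≢s (sym e)) = +-assoc (δ x _) _ _
redirect-pair x (inj₂ refl) r≢w s≢w r≢s
  rewrite redirect-target x s≢w | redirect-other x r≢w r≢s = x∙yz≈y∙xz (δ x _) (δ x _) _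

redirect-∈ : ∀ {w r x} {V W : List ℕ} → x ∈ V → (∀ {y} → y ∈ V → y ≢ w → y ∈ W) → r ∈ W → redirect w r x ∈ W
redirect-∈ {w} {r} {x} m old r∈ with x ≟ w
... | yes refl rewrite ≡ᵇ-refl x = r∈
... | no x≢w rewrite ≡ᵇ-≢ x≢w = old m x≢w

select : Bool → ℕ → ℕ → ℕ
select b r s = if b then r else s

select-∈ : ∀ b r s → select b r s ≡ r ⊎ select b r s ≡ s
select-∈ true  r s = inj₁ refl
select-∈ false r s = inj₂ refl

redirect-other-select : ∀ {w r s z} b x → z ≢ w → z ≢ r → z ≢ s → δ (redirect w (select b r s) x) z ≡ δ x z
redirect-other-select true  x z≢w z≢r z≢s = redirect-other x z≢w z≢r
redirect-other-select false x z≢w z≢r z≢s = redirect-other x z≢w z≢s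

module _ {V : List ℕ} {w : ℕ} (end : ℕ × ℕ → ℕ) (as : List (ℕ × ℕ)) (inV : All (λ a → end a ∈ V) as) where

  redirect-count : ∀ {r} → r ∉ V → r ≢ w → sumBy (λ a → δ (redirect w r (end a)) r) as ≡ sumBy (λ a → δ (end a) w) as
  redirect-count r∉ r≢w = sumBy-congOn _ _ as (All.map target inV)
    where
    target : ∀ {a} → end a ∈ V → δ (redirect w _ (end a)) _ ≡ δ (end a) w
    target {a} m = trans (redirect-target (end a) r≢w) (trans (cong (δ (end a) w +_) (δ-≢ (∈∉⇒≢ m r∉))) (+-identityʳ _))

  redirect-count-fresh : ∀ {r z} → z ∉ V → z ≢ w → z ≢ r → sumBy (λ a → δ (redirect w r (end a)) z) as ≡ 0
  redirect-count-fresh z∉ z≢w z≢r =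
    sumBy-zero _ as (All.map (λ {a} m → trans (redirect-other (end a) z≢w z≢r) (δ-≢ (∈∉⇒≢ m z∉))) inV)

  redirect-pair-fresh : ∀ {r s} → r ∉ V → s ∉ V → r ≢ w → s ≢ w → r ≢ s →
    All (λ a → ∀ b → δ (redirect w (select b r s) (end a)) r + δ (redirect w (select b r s) (end a)) s ≡ δ (end a) w) as
  redirect-pair-fresh {r} {s} r∉ s∉ r≢w s≢w r≢s = All.map pair inV
    where
    pair : ∀ {a} → end a ∈ V → ∀ b → δ (redirect w (select b r s) (end a)) r + δ (redirect w (select b r s) (end a)) s ≡ δ (end a) w
    pair {a} m b rewrite redirect-pair (end a) (select-∈ b r s) r≢w s≢w r≢s
                       | δ-≢ (∈∉⇒≢ m r∉) | δ-≢ (∈∉⇒≢ m s∉) = +-identityʳ _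

record FreshPair (V : List ℕ) (p q : ℕ) : Set where
  field
    p≢q : p ≢ q
    p∉  : p ∉ V
    q∉  : q ∉ V

freshPair : ∀ {V p q} → Fresh V (p ∷ q ∷ []) → FreshPair V p q
freshPair (((p≢q ∷ []) ∷ [] ∷ []) , (p∉ ∷ q∉ ∷ [])) = record { p≢q = p≢q ; p∉ = p∉ ; q∉ = q∉ }

record FreshTriple (V : List ℕ) (p q t : ℕ) : Set where
  field
    p≢q : p ≢ q
    p≢t : p ≢ t
    q≢t : q ≢ t
    p∉  : p ∉ V
    q∉  : q ∉ V
    t∉  : t ∉ V

freshTriple : ∀ {V p q t} → Fresh V (p ∷ q ∷ t ∷ []) → FreshTriple V p q t
freshTriple (((p≢q ∷ p≢t ∷ []) ∷ (q≢t ∷ []) ∷ [] ∷ []) , (p∉ ∷ q∉ ∷ t∉ ∷ [])) =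
  record { p≢q = p≢q ; p≢t = p≢t ; q≢t = q≢t ; p∉ = p∉ ; q∉ = q∉ ; t∉ = t∉ }

record LocalReplacement (G : DiGraph) (w : ℕ) (N : List ℕ) (G′ : DiGraph) : Set where
  field
    verts≡       : verts G′ ≡ replaceVertex w (verts G) N
    fresh        : All (λ x → x ∉ verts G) N
    wellFormed   : WellFormed G′
    indeg-other  : ∀ y → y ∈ verts G → y ≢ w → indeg G′ y ≡ indeg G y
    outdeg-other : ∀ y → y ∈ verts G → y ≢ w → outdeg G′ y ≡ outdeg G y

indeg-++ : ∀ V as bs y → indeg (mkDi V (as ++ bs)) y ≡ inD as y + inD bs y
indeg-++ V as bs y = trans (indeg≡inD (mkDi V (as ++ bs)) y) (sumBy-++ _ as bs)

outdeg-++ : ∀ V as bs y → outdeg (mkDi V (as ++ bs)) y ≡ outD as y + outD bs y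
outdeg-++ V as bs y = trans (outdeg≡outD (mkDi V (as ++ bs)) y) (sumBy-++ _ as bs)

module SplitDegrees (G : DiGraph) (w p q : ℕ) (wf : WellFormed G) (w∈ : w ∈ verts G)
                    (fresh : Fresh (verts G) (p ∷ q ∷ [])) where

  open FreshPair (freshPair fresh)

  V : List ℕ
  V = verts G
  A : List (ℕ × ℕ)
  A = arcs G
  G′ : DiGraph
  G′ = splitG G w p q
  moved : List (ℕ × ℕ)
  moved = map (splitArc w p q) A

  indeg-moved : ∀ y → inD moved y ≡ sumBy (λ a → δ (redirect w p (proj₂ a)) y) A
  indeg-moved y = sumBy-map (λ a → δ (proj₂ a) y) (splitArc w p q) A

  outdeg-moved : ∀ y → outD moved y ≡ sumBy (λ a → δ (redirect w q (proj₁ a)) y) A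
  outdeg-moved y = sumBy-map (λ a → δ (proj₁ a) y) (splitArc w p q) A

  module _ (y : ℕ) (y∈ : y ∈ V) (y≢w : y ≢ w) where
    private
      y≢p : y ≢ p
      y≢p = ∈∉⇒≢ y∈ p∉
      y≢q : y ≢ q
      y≢q = ∈∉⇒≢ y∈ q∉

    indeg-other : indeg G′ y ≡ indeg G y
    indeg-other rewrite indeg-++ (replaceVertex w V (p ∷ q ∷ [])) moved ((p , q) ∷ []) y
                      | indeg-moved y | δ-≢ (≢-sym y≢q) | indeg≡inD G y =
      trans (+-identityʳ _) (sumBy-cong _ _ A (λ a → redirect-other (proj₂ a) y≢w y≢p))

    outdeg-other : outdeg G′ y ≡ outdeg G y
    outdeg-other rewrite outdeg-++ (replaceVertex w V (p ∷ q ∷ [])) moved ((p , q) ∷ []) y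
                       | outdeg-moved y | δ-≢ (≢-sym y≢p) | outdeg≡outD G y =
      trans (+-identityʳ _) (sumBy-cong _ _ A (λ a → redirect-other (proj₁ a) y≢w y≢q))

  private
    tails∈ : All (λ a → proj₁ a ∈ V) A
    tails∈ = All.map proj₁ (proj₂ wf)
    heads∈ : All (λ a → proj₂ a ∈ V) A
    heads∈ = All.map proj₂ (proj₂ wf)
    p≢w : p ≢ w
    p≢w = ≢-sym (∈∉⇒≢ w∈ p∉)
    q≢w : q ≢ w
    q≢w = ≢-sym (∈∉⇒≢ w∈ q∉)
    V′ : List ℕ
    V′ = replaceVertex w V (p ∷ q ∷ [])

  indeg-p : indeg G′ p ≡ indeg G w
  indeg-p rewrite indeg-++ V′ moved ((p , q) ∷ []) p | indeg-moved p | δ-≢ (≢-sym p≢q) | indeg≡inD G w =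
    trans (+-identityʳ _) (redirect-count proj₂ A heads∈ p∉ p≢w)

  outdeg-p : outdeg G′ p ≡ 1
  outdeg-p rewrite outdeg-++ V′ moved ((p , q) ∷ []) p | outdeg-moved p | δ-refl p
                 | redirect-count-fresh proj₁ A tails∈ p∉ p≢w p≢q = refl

  indeg-q : indeg G′ q ≡ 1
  indeg-q rewrite indeg-++ V′ moved ((p , q) ∷ []) q | indeg-moved q | δ-refl q
                | redirect-count-fresh proj₂ A heads∈ q∉ q≢w (≢-sym p≢q) = refl

  outdeg-q : outdeg G′ q ≡ outdeg G w
  outdeg-q rewrite outdeg-++ V′ moved ((p , q) ∷ []) q | outdeg-moved q | δ-≢ p≢q | outdeg≡outD G w =
    trans (+-identityʳ _) (redirect-count proj₁ A tails∈ q∉ q≢w)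

  replacement : LocalReplacement G w (p ∷ q ∷ []) G′
  replacement = record
    { verts≡       = refl
    ; fresh        = proj₂ fresh
    ; wellFormed   = replace-unique V N (proj₁ wf) fresh ,
                     ++⁺ (map⁺ (All.map (λ (m₁ , m₂) → redirect-∈ m₁ old q∈ , redirect-∈ m₂ old p∈) (proj₂ wf)))
                         ((p∈ , q∈) ∷ [])
    ; indeg-other  = indeg-other
    ; outdeg-other = outdeg-other
    }
    where
    N : List ℕ
    N = p ∷ q ∷ []
    old : ∀ {y} → y ∈ V → y ≢ w → y ∈ V′
    old = ∈-replace-old V N
    p∈ : p ∈ V′
    p∈ = ∈-replace-new V N (here refl)
    q∈ : q ∈ V′
    q∈ = ∈-replace-new V N (there (here refl))

module InSplitDegrees (G : DiGraph) (w p q t : ℕ) (bs : List Bool) (wf : WellFormed G) (w∈ : w ∈ verts G)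
                      (fresh : Fresh (verts G) (p ∷ q ∷ t ∷ [])) (len : length bs ≡ length (arcs G)) where

  open FreshTriple (freshTriple fresh)

  V : List ℕ
  V = verts G
  A : List (ℕ × ℕ)
  A = arcs G
  N : List ℕ
  N = p ∷ q ∷ t ∷ []
  G′ : DiGraph
  G′ = inSplitG G w p q t bs
  moved : List (ℕ × ℕ)
  moved = inSplitArcs G w p q t bs
  internal : List (ℕ × ℕ)
  internal = (p , q) ∷ (q , p) ∷ (p , t) ∷ (q , t) ∷ []

  private
    tails∈ : All (λ a → proj₁ a ∈ V) A
    tails∈ = All.map proj₁ (proj₂ wf)
    heads∈ : All (λ a → proj₂ a ∈ V) A
    heads∈ = All.map proj₂ (proj₂ wf)
    p≢w : p ≢ w
    p≢w = ≢-sym (∈∉⇒≢ w∈ p∉)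
    q≢w : q ≢ w
    q≢w = ≢-sym (∈∉⇒≢ w∈ q∉)
    t≢w : t ≢ w
    t≢w = ≢-sym (∈∉⇒≢ w∈ t∉)
    V′ : List ℕ
    V′ = replaceVertex w V N

  -- Tails of moved arcs are redirected to t, regardless of the tag.
  outdeg-moved : ∀ y → outD moved y ≡ sumBy (λ a → δ (redirect w t (proj₁ a)) y) A
  outdeg-moved y = sumBy-zipWith _ (inArc w p q t) _ bs A len (All.universal (λ _ _ → refl) A)

  module _ (y : ℕ) (y∈ : y ∈ V) (y≢w : y ≢ w) where
    private
      y≢p : y ≢ p
      y≢p = ∈∉⇒≢ y∈ p∉
      y≢q : y ≢ q
      y≢q = ∈∉⇒≢ y∈ q∉
      y≢t : y ≢ t
      y≢t = ∈∉⇒≢ y∈ t∉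

    indeg-other : indeg G′ y ≡ indeg G y
    indeg-other rewrite indeg-++ V′ moved internal y | δ-≢ (≢-sym y≢p) | δ-≢ (≢-sym y≢q) | δ-≢ (≢-sym y≢t)
                      | indeg≡inD G y =
      trans (+-identityʳ _) (sumBy-zipWith _ (inArc w p q t) _ bs A len
        (All.universal (λ a b → redirect-other-select b (proj₂ a) y≢w y≢p y≢q) A))

    outdeg-other : outdeg G′ y ≡ outdeg G y
    outdeg-other rewrite outdeg-++ V′ moved internal y | outdeg-moved y | δ-≢ (≢-sym y≢p) | δ-≢ (≢-sym y≢q)
                       | outdeg≡outD G y =
      trans (+-identityʳ _) (sumBy-cong _ _ A (λ a → redirect-other (proj₁ a) y≢w y≢t))

  indeg-p : indeg G′ p ≡ suc (countTo p moved)
  indeg-p rewrite indeg-++ V′ moved internal p | δ-refl p | δ-≢ (≢-sym p≢q) | δ-≢ (≢-sym p≢t)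
                | count≡sumBy (λ a → proj₂ a ≡ᵇ p) moved = +-comm _ 1

  indeg-q : indeg G′ q ≡ suc (countTo q moved)
  indeg-q rewrite indeg-++ V′ moved internal q | δ-refl q | δ-≢ p≢q | δ-≢ (≢-sym q≢t)
                | count≡sumBy (λ a → proj₂ a ≡ᵇ q) moved = +-comm _ 1

  count-pq : countTo p moved + countTo q moved ≡ indeg G w
  count-pq = begin
    countTo p moved + countTo q moved   ≡⟨ cong₂ _+_ (count≡sumBy _ moved) (count≡sumBy _ moved) ⟩
    inD moved p + inD moved q           ≡⟨ sym (sumBy-+ _ _ moved) ⟩
    sumBy (λ c → δ (proj₂ c) p + δ (proj₂ c) q) moved
      ≡⟨ sumBy-zipWith _ (inArc w p q t) _ bs A len (redirect-pair-fresh proj₂ A heads∈ p∉ q∉ p≢w q≢w p≢q) ⟩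
    inD A w                             ≡⟨ sym (indeg≡inD G w) ⟩
    indeg G w                           ∎
    where open ≡-Reasoning

  outdeg-p : outdeg G′ p ≡ 2
  outdeg-p rewrite outdeg-++ V′ moved internal p | outdeg-moved p | δ-refl p | δ-≢ (≢-sym p≢q)
                 | redirect-count-fresh proj₁ A tails∈ p∉ p≢w p≢t = refl

  outdeg-q : outdeg G′ q ≡ 2
  outdeg-q rewrite outdeg-++ V′ moved internal q | outdeg-moved q | δ-refl q | δ-≢ p≢q
                 | redirect-count-fresh proj₁ A tails∈ q∉ q≢w q≢t = refl

  indeg-t : indeg G′ t ≡ 2
  indeg-t rewrite indeg-++ V′ moved internal t | δ-refl t | δ-≢ q≢t | δ-≢ p≢t
                | sumBy-zipWith (λ c → δ (proj₂ c) t) (inArc w p q t) (λ _ → 0) bs A len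
                    (All.map (λ {a} m b → trans (redirect-other-select b (proj₂ a) t≢w (≢-sym p≢t) (≢-sym q≢t)) (δ-≢ (∈∉⇒≢ m t∉))) heads∈)
                | sumBy-const 0 A = refl

  outdeg-t : outdeg G′ t ≡ outdeg G w
  outdeg-t rewrite outdeg-++ V′ moved internal t | outdeg-moved t | δ-≢ p≢t | δ-≢ q≢t | outdeg≡outD G w =
    trans (+-identityʳ _) (redirect-count proj₁ A tails∈ t∉ t≢w)

  replacement : LocalReplacement G w N G′
  replacement = record
    { verts≡       = refl
    ; fresh        = proj₂ fresh
    ; wellFormed   = replace-unique V N (proj₁ wf) fresh ,
                     ++⁺ (zipWith-ends (proj₂ wf)) ((p∈ , q∈) ∷ (q∈ , p∈) ∷ (p∈ , t∈) ∷ (q∈ , t∈) ∷ [])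
    ; indeg-other  = indeg-other
    ; outdeg-other = outdeg-other
    }
    where
    old : ∀ {y} → y ∈ V → y ≢ w → y ∈ V′
    old = ∈-replace-old V N
    p∈ : p ∈ V′
    p∈ = ∈-replace-new V N (here refl)
    q∈ : q ∈ V′
    q∈ = ∈-replace-new V N (there (here refl))
    t∈ : t ∈ V′
    t∈ = ∈-replace-new V N (there (there (here refl)))
    zipWith-ends : ∀ {bs′ as} → Ends V as → Ends V′ (zipWith (inArc w p q t) bs′ as)
    zipWith-ends {[]}     {_}      _                = []
    zipWith-ends {_ ∷ _}  {[]}     _                = []
    zipWith-ends {b ∷ bs′} {a ∷ as} ((m₁ , m₂) ∷ es) =
      (redirect-∈ m₁ old t∈ , redirect-∈ m₂ old (sel b)) ∷ zipWith-ends es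
      where
      sel : ∀ b → select b p q ∈ V′
      sel true  = p∈
      sel false = q∈

module OutSplitDegrees (G : DiGraph) (w p q t : ℕ) (bs : List Bool) (wf : WellFormed G) (w∈ : w ∈ verts G)
                       (fresh : Fresh (verts G) (p ∷ q ∷ t ∷ [])) (len : length bs ≡ length (arcs G)) where

  open FreshTriple (freshTriple fresh)

  V : List ℕ
  V = verts G
  A : List (ℕ × ℕ)
  A = arcs G
  N : List ℕ
  N = p ∷ q ∷ t ∷ []
  G′ : DiGraph
  G′ = outSplitG G w p q t bs
  moved : List (ℕ × ℕ)
  moved = outSplitArcs G w p q t bs
  internal : List (ℕ × ℕ)
  internal = (p , q) ∷ (p , t) ∷ (q , t) ∷ (t , q) ∷ []

  private
    tails∈ : All (λ a → proj₁ a ∈ V) A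
    tails∈ = All.map proj₁ (proj₂ wf)
    heads∈ : All (λ a → proj₂ a ∈ V) A
    heads∈ = All.map proj₂ (proj₂ wf)
    p≢w : p ≢ w
    p≢w = ≢-sym (∈∉⇒≢ w∈ p∉)
    q≢w : q ≢ w
    q≢w = ≢-sym (∈∉⇒≢ w∈ q∉)
    t≢w : t ≢ w
    t≢w = ≢-sym (∈∉⇒≢ w∈ t∉)
    V′ : List ℕ
    V′ = replaceVertex w V N

  -- Heads of moved arcs are redirected to p, regardless of the tag.
  indeg-moved : ∀ y → inD moved y ≡ sumBy (λ a → δ (redirect w p (proj₂ a)) y) A
  indeg-moved y = sumBy-zipWith _ (outArc w p q t) _ bs A len (All.universal (λ _ _ → refl) A)

  module _ (y : ℕ) (y∈ : y ∈ V) (y≢w : y ≢ w) where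
    private
      y≢p : y ≢ p
      y≢p = ∈∉⇒≢ y∈ p∉
      y≢q : y ≢ q
      y≢q = ∈∉⇒≢ y∈ q∉
      y≢t : y ≢ t
      y≢t = ∈∉⇒≢ y∈ t∉

    indeg-other : indeg G′ y ≡ indeg G y
    indeg-other rewrite indeg-++ V′ moved internal y | indeg-moved y | δ-≢ (≢-sym y≢q) | δ-≢ (≢-sym y≢t)
                      | indeg≡inD G y =
      trans (+-identityʳ _) (sumBy-cong _ _ A (λ a → redirect-other (proj₂ a) y≢w y≢p))

    outdeg-other : outdeg G′ y ≡ outdeg G y
    outdeg-other rewrite outdeg-++ V′ moved internal y | δ-≢ (≢-sym y≢p) | δ-≢ (≢-sym y≢q) | δ-≢ (≢-sym y≢t)
                       | outdeg≡outD G y =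
      trans (+-identityʳ _) (sumBy-zipWith _ (outArc w p q t) _ bs A len
        (All.universal (λ a b → redirect-other-select b (proj₁ a) y≢w y≢q y≢t) A))

  indeg-p : indeg G′ p ≡ indeg G w
  indeg-p rewrite indeg-++ V′ moved internal p | indeg-moved p | δ-≢ (≢-sym p≢q) | δ-≢ (≢-sym p≢t)
                | indeg≡inD G w =
    trans (+-identityʳ _) (redirect-count proj₂ A heads∈ p∉ p≢w)

  outdeg-p : outdeg G′ p ≡ 2
  outdeg-p rewrite outdeg-++ V′ moved internal p | δ-refl p | δ-≢ (≢-sym p≢q) | δ-≢ (≢-sym p≢t)
                 | sumBy-zipWith (λ c → δ (proj₁ c) p) (outArc w p q t) (λ _ → 0) bs A len
                     (All.map (λ {a} m b → trans (redirect-other-select b (proj₁ a) p≢w p≢q p≢t) (δ-≢ (∈∉⇒≢ m p∉))) tails∈)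
                 | sumBy-const 0 A = refl

  indeg-q : indeg G′ q ≡ 2
  indeg-q rewrite indeg-++ V′ moved internal q | indeg-moved q | δ-refl q | δ-≢ (≢-sym q≢t)
                | redirect-count-fresh proj₂ A heads∈ q∉ q≢w (≢-sym p≢q) = refl

  indeg-t : indeg G′ t ≡ 2
  indeg-t rewrite indeg-++ V′ moved internal t | indeg-moved t | δ-refl t | δ-≢ q≢t
                | redirect-count-fresh proj₂ A heads∈ t∉ t≢w (≢-sym p≢t) = refl

  outdeg-q : outdeg G′ q ≡ suc (countFrom q moved)
  outdeg-q rewrite outdeg-++ V′ moved internal q | δ-refl q | δ-≢ p≢q | δ-≢ (≢-sym q≢t)
                 | count≡sumBy (λ a → proj₁ a ≡ᵇ q) moved = +-comm _ 1

  outdeg-t : outdeg G′ t ≡ suc (countFrom t moved)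
  outdeg-t rewrite outdeg-++ V′ moved internal t | δ-refl t | δ-≢ p≢t | δ-≢ q≢t
                 | count≡sumBy (λ a → proj₁ a ≡ᵇ t) moved = +-comm _ 1

  count-qt : countFrom q moved + countFrom t moved ≡ outdeg G w
  count-qt = begin
    countFrom q moved + countFrom t moved   ≡⟨ cong₂ _+_ (count≡sumBy _ moved) (count≡sumBy _ moved) ⟩
    outD moved q + outD moved t             ≡⟨ sym (sumBy-+ _ _ moved) ⟩
    sumBy (λ c → δ (proj₁ c) q + δ (proj₁ c) t) moved
      ≡⟨ sumBy-zipWith _ (outArc w p q t) _ bs A len (redirect-pair-fresh proj₁ A tails∈ q∉ t∉ q≢w t≢w q≢t) ⟩
    outD A w                                ≡⟨ sym (outdeg≡outD G w) ⟩
    outdeg G w                              ∎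
    where open ≡-Reasoning

  replacement : LocalReplacement G w N G′
  replacement = record
    { verts≡       = refl
    ; fresh        = proj₂ fresh
    ; wellFormed   = replace-unique V N (proj₁ wf) fresh ,
                     ++⁺ (zipWith-ends (proj₂ wf)) ((p∈ , q∈) ∷ (p∈ , t∈) ∷ (q∈ , t∈) ∷ (t∈ , q∈) ∷ [])
    ; indeg-other  = indeg-other
    ; outdeg-other = outdeg-other
    }
    where
    old : ∀ {y} → y ∈ V → y ≢ w → y ∈ V′
    old = ∈-replace-old V N
    p∈ : p ∈ V′
    p∈ = ∈-replace-new V N (here refl)
    q∈ : q ∈ V′
    q∈ = ∈-replace-new V N (there (here refl))
    t∈ : t ∈ V′
    t∈ = ∈-replace-new V N (there (there (here refl)))
    zipWith-ends : ∀ {bs′ as} → Ends V as → Ends V′ (zipWith (outArc w p q t) bs′ as)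
    zipWith-ends {[]}      {_}      _                = []
    zipWith-ends {_ ∷ _}   {[]}     _                = []
    zipWith-ends {b ∷ bs′} {a ∷ as} ((m₁ , m₂) ∷ es) =
      (redirect-∈ m₁ old (sel b) , redirect-∈ m₂ old p∈) ∷ zipWith-ends es
      where
      sel : ∀ b → select b q t ∈ V′
      sel true  = q∈
      sel false = t∈

-- The cost of a vertex: cost i o is the weight of the final vertices descending from a vertex of
-- in-degree i and out-degree o: for i, o ≤ 3 it is the weight of a_v, b_v, c_v
-- in step (2) (cost-small below), it does not increase under the three
-- splits, and it is at most 25 (i + o) unless the vertex is isolated.

sideCost : ℕ → ℕ
sideCost 0 = 0
sideCost 1 = 3
sideCost 2 = 0
sideCost (suc (suc (suc n))) = 13 + 25 * n

-- Extra cost of a vertex that is high on both sides: the initial split.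
bothHighBonus : ℕ → ℕ → ℕ
bothHighBonus (suc (suc (suc (suc i)))) (suc (suc (suc (suc o)))) = 12
bothHighBonus _ _ = 0

cost : ℕ → ℕ → ℕ
cost i o = 6 + sideCost i + sideCost o + bothHighBonus i o

bothHighBonus-low : ∀ i {o} → o ≤ 3 → bothHighBonus i o ≡ 0
bothHighBonus-low 0 _ = refl
bothHighBonus-low 1 _ = refl
bothHighBonus-low 2 _ = refl
bothHighBonus-low 3 _ = refl
bothHighBonus-low (suc (suc (suc (suc i)))) {0} _ = refl
bothHighBonus-low (suc (suc (suc (suc i)))) {1} _ = refl
bothHighBonus-low (suc (suc (suc (suc i)))) {2} _ = refl
bothHighBonus-low (suc (suc (suc (suc i)))) {3} _ = refl
bothHighBonus-low (suc (suc (suc (suc i)))) {suc (suc (suc (suc o)))} (s≤s (s≤s (s≤s ())))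

2≤3 : 2 ≤ 3
2≤3 = s≤s (s≤s z≤n)

-- Dividing a side of degree a + b > 3 in balanced parts a, b (each part also
-- receiving one internal arc) saves at least the 12 of the two new vertices.
sideCost-balanced : ∀ a b → 3 < a + b → a ≤ suc b → b ≤ suc a → 12 + sideCost (suc a) + sideCost (suc b) ≤ sideCost (a + b)
sideCost-balanced 0 b h ab ba with ≤-trans h ba
... | s≤s ()
sideCost-balanced 1 0 (s≤s ()) ab ba
sideCost-balanced 1 1 (s≤s (s≤s ())) ab ba
sideCost-balanced 1 2 (s≤s (s≤s (s≤s ()))) ab ba
sideCost-balanced 1 (suc (suc (suc b))) h ab (s≤s (s≤s ()))
sideCost-balanced (suc (suc a)) 0 h (s≤s ()) ba
sideCost-balanced 2 1 (s≤s (s≤s (s≤s ()))) ab ba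
sideCost-balanced (suc (suc (suc a))) 1 h (s≤s (s≤s ())) ba
sideCost-balanced (suc (suc a)) (suc (suc b)) h ab ba rewrite +-suc a (suc b) | +-suc a b = ≤-reflexive (eq a b)
  where
  eq : ∀ a b → 12 + (13 + 25 * a) + (13 + 25 * b) ≡ 13 + 25 * suc (a + b)
  eq = solve-∀

cost-split : ∀ i o → 3 < i → 3 < o → cost i 1 + (cost 1 o + 0) ≤ cost i o
cost-split (suc (suc (suc (suc i)))) (suc (suc (suc (suc o)))) (s≤s (s≤s (s≤s (s≤s _)))) (s≤s (s≤s (s≤s (s≤s _)))) =
  ≤-reflexive (eq (sideCost (suc (suc (suc (suc i))))) (sideCost (suc (suc (suc (suc o))))))
  where
  eq : ∀ x y → 6 + x + 3 + 0 + (6 + 3 + y + 0 + 0) ≡ 6 + x + y + 12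
  eq = solve-∀

cost-inSplit : ∀ a b o → 3 < a + b → a ≤ suc b → b ≤ suc a →
  cost (suc a) 2 + (cost (suc b) 2 + (cost 2 o + 0)) ≤ cost (a + b) o
cost-inSplit a b o h ab ba rewrite bothHighBonus-low (suc a) 2≤3 | bothHighBonus-low (suc b) 2≤3 = begin
  6 + sideCost (suc a) + 0 + 0 + (6 + sideCost (suc b) + 0 + 0 + (6 + 0 + sideCost o + bothHighBonus 2 o + 0))
    ≡⟨ eq (sideCost (suc a)) (sideCost (suc b)) (sideCost o) ⟩
  6 + (12 + sideCost (suc a) + sideCost (suc b)) + sideCost o
    ≤⟨ +-monoʳ-≤ 6 (+-monoˡ-≤ (sideCost o) (sideCost-balanced a b h ab ba)) ⟩
  6 + sideCost (a + b) + sideCost o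
    ≤⟨ m≤m+n _ _ ⟩
  cost (a + b) o ∎
  where
  open ≤-Reasoning
  eq : ∀ x y z → 6 + x + 0 + 0 + (6 + y + 0 + 0 + (6 + 0 + z + 0 + 0)) ≡ 6 + (12 + x + y) + z
  eq = solve-∀

cost-outSplit : ∀ a b i → 3 < a + b → a ≤ suc b → b ≤ suc a →
  cost i 2 + (cost 2 (suc a) + (cost 2 (suc b) + 0)) ≤ cost i (a + b)
cost-outSplit a b i h ab ba rewrite bothHighBonus-low i 2≤3 = begin
  6 + sideCost i + 0 + 0 + (6 + 0 + sideCost (suc a) + 0 + (6 + 0 + sideCost (suc b) + 0 + 0))
    ≡⟨ eq (sideCost (suc a)) (sideCost (suc b)) (sideCost i) ⟩
  6 + sideCost i + (12 + sideCost (suc a) + sideCost (suc b))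
    ≤⟨ +-monoʳ-≤ (6 + sideCost i) (sideCost-balanced a b h ab ba) ⟩
  6 + sideCost i + sideCost (a + b)
    ≤⟨ m≤m+n _ _ ⟩
  cost i (a + b) ∎
  where
  open ≤-Reasoning
  eq : ∀ x y z → 6 + z + 0 + 0 + (6 + 0 + x + 0 + (6 + 0 + y + 0 + 0)) ≡ 6 + z + (12 + x + y)
  eq = solve-∀

sideCost-linear : ∀ n → sideCost (suc n) + 12 ≤ 25 * suc n
sideCost-linear 0 = m≤m+n 15 10
sideCost-linear 1 = m≤m+n 12 38
sideCost-linear 2 = m≤m+n 25 50
sideCost-linear (suc (suc (suc m))) = ≤-trans (≤-reflexive (eq₁ m)) (≤-trans (m≤n+m (50 + 25 * m) 50) (≤-reflexive (eq₂ m)))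
  where
  eq₁ : ∀ m → 13 + 25 * suc m + 12 ≡ 50 + 25 * m
  eq₁ = solve-∀
  eq₂ : ∀ m → 50 + (50 + 25 * m) ≡ 25 * suc (suc (suc (suc m)))
  eq₂ = solve-∀

bothHighBonus-≤ : ∀ i o → bothHighBonus i o ≤ 12
bothHighBonus-≤ (suc (suc (suc (suc i)))) (suc (suc (suc (suc o)))) = ≤-refl
bothHighBonus-≤ 0 o = z≤n
bothHighBonus-≤ 1 o = z≤n
bothHighBonus-≤ 2 o = z≤n
bothHighBonus-≤ 3 o = z≤n
bothHighBonus-≤ (suc (suc (suc (suc i)))) 0 = z≤n
bothHighBonus-≤ (suc (suc (suc (suc i)))) 1 = z≤n
bothHighBonus-≤ (suc (suc (suc (suc i)))) 2 = z≤n
bothHighBonus-≤ (suc (suc (suc (suc i)))) 3 = z≤n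

cost-linear : ∀ i o → 0 < i ⊎ 0 < o → cost i o ≤ 25 * (i + o)
cost-linear 0       0       (inj₁ ())
cost-linear 0       0       (inj₂ ())
cost-linear 0       (suc o) _ = begin
  6 + sideCost (suc o) + 0   ≡⟨ eq (sideCost (suc o)) ⟩
  sideCost (suc o) + 6       ≤⟨ +-monoʳ-≤ (sideCost (suc o)) (m≤m+n 6 6) ⟩
  sideCost (suc o) + 12      ≤⟨ sideCost-linear o ⟩
  25 * suc o                 ∎
  where
  open ≤-Reasoning
  eq : ∀ x → 6 + x + 0 ≡ x + 6
  eq = solve-∀
cost-linear (suc i) 0       _ rewrite bothHighBonus-low (suc i) (z≤n {3}) = begin
  6 + sideCost (suc i) + 0 + 0   ≡⟨ eq (sideCost (suc i)) ⟩
  sideCost (suc i) + 6           ≤⟨ +-monoʳ-≤ (sideCost (suc i)) (m≤m+n 6 6) ⟩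
  sideCost (suc i) + 12          ≤⟨ sideCost-linear i ⟩
  25 * suc i                     ≡⟨ cong (25 *_) (sym (+-identityʳ (suc i))) ⟩
  25 * (suc i + 0)               ∎
  where
  open ≤-Reasoning
  eq : ∀ x → 6 + x + 0 + 0 ≡ x + 6
  eq = solve-∀
cost-linear (suc i) (suc o) _ = begin
  6 + sideCost (suc i) + sideCost (suc o) + bothHighBonus (suc i) (suc o)
    ≤⟨ +-monoʳ-≤ (6 + sideCost (suc i) + sideCost (suc o)) (bothHighBonus-≤ (suc i) (suc o)) ⟩
  6 + sideCost (suc i) + sideCost (suc o) + 12
    ≤⟨ +-monoˡ-≤ 12 (+-monoˡ-≤ (sideCost (suc o)) (+-monoˡ-≤ (sideCost (suc i)) (m≤m+n 6 6))) ⟩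
  12 + sideCost (suc i) + sideCost (suc o) + 12
    ≡⟨ eq (sideCost (suc i)) (sideCost (suc o)) ⟩
  (sideCost (suc i) + 12) + (sideCost (suc o) + 12)
    ≤⟨ +-mono-≤ (sideCost-linear i) (sideCost-linear o) ⟩
  25 * suc i + 25 * suc o
    ≡⟨ sym (*-distribˡ-+ 25 (suc i) (suc o)) ⟩
  25 * (suc i + suc o) ∎
  where
  open ≤-Reasoning
  eq : ∀ x y → 12 + x + y + 12 ≡ (x + 12) + (y + 12)
  eq = solve-∀

costAt : DiGraph → ℕ → ℕ
costAt G y = cost (indeg G y) (outdeg G y)

Φ : DiGraph → ℕ
Φ G = sumBy (costAt G) (verts G)

replacement-Φ : ∀ {G w N G′} → LocalReplacement G w N G′ → Unique (verts G) → w ∈ verts G →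
  sumBy (costAt G′) N ≤ costAt G w → Φ G′ ≤ Φ G
replacement-Φ {G} {w} {N} {G′} R u w∈ cheap =
  subst (λ L → sumBy (costAt G′) L ≤ Φ G) (sym verts≡)
        (replace-potential (verts G) N (costAt G) (costAt G′) u w∈
          (λ y y∈ y≢w → cong₂ cost (indeg-other y y∈ y≢w) (outdeg-other y y∈ y≢w)) cheap)
  where open LocalReplacement R

record SplitInvariant (G₀ : DiGraph) (v : ℕ) (G : DiGraph) (S : List ℕ) : Set where
  field
    wellFormed : WellFormed G
    inside     : All (_∈ verts G) S
    untouched  : All (λ y → y ≢ v → y ∈ verts G × y ∉ S × indeg G y ≡ indeg G₀ y × outdeg G y ≡ outdeg G₀ y) (verts G₀)
    covered    : All (λ y → y ∈ S ⊎ (y ∈ verts G₀ × y ≢ v)) (verts G)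
    potential  : Φ G ≤ Φ G₀

invariant-step : ∀ {G₀ v G S w N G′} → SplitInvariant G₀ v G S → w ∈ S → LocalReplacement G w N G′ →
  sumBy (costAt G′) N ≤ costAt G w → SplitInvariant G₀ v G′ (replaceVertex w S N)
invariant-step {G₀} {v} {G} {S} {w} {N} {G′} I w∈S R cheap = record
  { wellFormed = R.wellFormed
  ; inside     = All.tabulate inside′
  ; untouched  = All.map untouched′ I.untouched
  ; covered    = All.tabulate covered′
  ; potential  = ≤-trans (replacement-Φ R (proj₁ I.wellFormed) w∈G cheap) I.potential
  }
  where
  module I = SplitInvariant I
  module R = LocalReplacement R
  w∈G : w ∈ verts G
  w∈G = All.lookup I.inside w∈S
  toG′ : ∀ {y} → y ∈ replaceVertex w (verts G) N → y ∈ verts G′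
  toG′ = subst (_ ∈_) (sym R.verts≡)
  inside′ : ∀ {y} → y ∈ replaceVertex w S N → y ∈ verts G′
  inside′ m with ∈-replace⁻ S N m
  ... | inj₁ (y∈S , y≢w) = toG′ (∈-replace-old (verts G) N (All.lookup I.inside y∈S) y≢w)
  ... | inj₂ y∈N         = toG′ (∈-replace-new (verts G) N y∈N)
  untouched′ : ∀ {y} → (y ≢ v → y ∈ verts G × y ∉ S × indeg G y ≡ indeg G₀ y × outdeg G y ≡ outdeg G₀ y) →
               (y ≢ v → y ∈ verts G′ × y ∉ replaceVertex w S N × indeg G′ y ≡ indeg G₀ y × outdeg G′ y ≡ outdeg G₀ y)
  untouched′ {y} old y≢v with old y≢v
  ... | y∈G , y∉S , in≡ , out≡ =
    toG′ (∈-replace-old (verts G) N y∈G y≢w) , y∉S′ ,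
    trans (R.indeg-other y y∈G y≢w) in≡ , trans (R.outdeg-other y y∈G y≢w) out≡
    where
    y≢w : y ≢ w
    y≢w refl = y∉S w∈S
    y∉S′ : y ∉ replaceVertex w S N
    y∉S′ m with ∈-replace⁻ S N m
    ... | inj₁ (y∈S , _) = y∉S y∈S
    ... | inj₂ y∈N       = All.lookup R.fresh y∈N y∈G
  covered′ : ∀ {y} → y ∈ verts G′ → y ∈ replaceVertex w S N ⊎ (y ∈ verts G₀ × y ≢ v)
  covered′ m with ∈-replace⁻ (verts G) N (subst (_ ∈_) R.verts≡ m)
  ... | inj₂ y∈N = inj₁ (∈-replace-new S N y∈N)
  ... | inj₁ (y∈G , y≢w) with All.lookup I.covered y∈G
  ...   | inj₁ y∈S  = inj₁ (∈-replace-old S N y∈S y≢w)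
  ...   | inj₂ orig = inj₂ orig

Invariant : DiGraph → ℕ → SState → Set
Invariant G₀ v (G , S) = SplitInvariant G₀ v G S

invariant-init : ∀ {G₀ v} → WellFormed G₀ → v ∈ verts G₀ → SplitInvariant G₀ v G₀ (v ∷ [])
invariant-init {G₀} {v} wf v∈ = record
  { wellFormed = wf
  ; inside     = v∈ ∷ []
  ; untouched  = All.tabulate (λ y∈ y≢v → y∈ , (λ { (here y≡v) → y≢v y≡v }) , refl , refl)
  ; covered    = All.tabulate cover
  ; potential  = ≤-refl
  }
  where
  cover : ∀ {y} → y ∈ verts G₀ → y ∈ v ∷ [] ⊎ (y ∈ verts G₀ × y ≢ v)
  cover {y} y∈ with y ≟ v
  ... | yes y≡v = inj₁ (here y≡v)
  ... | no  y≢v = inj₂ (y∈ , y≢v)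

invariant-split : ∀ {G₀ v p q} → WellFormed G₀ → v ∈ verts G₀ → 3 < indeg G₀ v → 3 < outdeg G₀ v →
  Fresh (verts G₀) (p ∷ q ∷ []) → Invariant G₀ v (splitG G₀ v p q , p ∷ q ∷ [])
invariant-split {G₀} {v} {p} {q} wf v∈ highIn highOut fresh =
  subst (SplitInvariant G₀ v (splitG G₀ v p q)) (cong (_++ p ∷ q ∷ []) removeSelf)
    (invariant-step (invariant-init wf v∈) (here refl) replacement cheap)
  where
  open SplitDegrees G₀ v p q wf v∈ fresh
  removeSelf : remove v (v ∷ []) ≡ []
  removeSelf rewrite ≡ᵇ-refl v = refl
  cheap : sumBy (costAt G′) (p ∷ q ∷ []) ≤ costAt G₀ v
  cheap = subst (_≤ costAt G₀ v)
    (sym (cong₂ _+_ (cong₂ cost indeg-p outdeg-p) (cong (_+ 0) (cong₂ cost indeg-q outdeg-q))))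
    (cost-split (indeg G₀ v) (outdeg G₀ v) highIn highOut)

invariant-inSplit : ∀ {G₀ v s s′} → Invariant G₀ v s → InSplitStep 3 s s′ → Invariant G₀ v s′
invariant-inSplit {s = G , S} I (inSplit w p q t bs w∈S high fresh len (bal₁ , bal₂)) =
  invariant-step I w∈S replacement cheap
  where
  open InSplitDegrees G w p q t bs (SplitInvariant.wellFormed I) (All.lookup (SplitInvariant.inside I) w∈S) fresh len
  cheap : sumBy (costAt G′) N ≤ costAt G w
  cheap = begin
    costAt G′ p + (costAt G′ q + (costAt G′ t + 0))
      ≡⟨ cong₂ _+_ (cong₂ cost indeg-p outdeg-p) (cong₂ _+_ (cong₂ cost indeg-q outdeg-q) (cong (_+ 0) (cong₂ cost indeg-t outdeg-t))) ⟩
    cost (suc (countTo p moved)) 2 + (cost (suc (countTo q moved)) 2 + (cost 2 (outdeg G w) + 0))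
      ≤⟨ cost-inSplit _ _ (outdeg G w) (subst (3 <_) (sym count-pq) high) bal₁ bal₂ ⟩
    cost (countTo p moved + countTo q moved) (outdeg G w)
      ≡⟨ cong (λ i → cost i (outdeg G w)) count-pq ⟩
    costAt G w ∎
    where open ≤-Reasoning

invariant-outSplit : ∀ {G₀ v s s′} → Invariant G₀ v s → InDone 3 s → OutSplitStep 3 s s′ → Invariant G₀ v s′ × InDone 3 s′
invariant-outSplit {s = G , S} I lowIn (outSplit w p q t bs w∈S high fresh len (bal₁ , bal₂)) =
  invariant-step I w∈S replacement cheap , ++⁺ (All.tabulate lowOld) (lowP ∷ lowQ ∷ lowT ∷ [])
  where
  module I = SplitInvariant I
  open OutSplitDegrees G w p q t bs I.wellFormed (All.lookup I.inside w∈S) fresh len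
  cheap : sumBy (costAt G′) N ≤ costAt G w
  cheap = begin
    costAt G′ p + (costAt G′ q + (costAt G′ t + 0))
      ≡⟨ cong₂ _+_ (cong₂ cost indeg-p outdeg-p) (cong₂ _+_ (cong₂ cost indeg-q outdeg-q) (cong (_+ 0) (cong₂ cost indeg-t outdeg-t))) ⟩
    cost (indeg G w) 2 + (cost 2 (suc (countFrom q moved)) + (cost 2 (suc (countFrom t moved)) + 0))
      ≤⟨ cost-outSplit _ _ (indeg G w) (subst (3 <_) (sym count-qt) high) bal₁ bal₂ ⟩
    cost (indeg G w) (countFrom q moved + countFrom t moved)
      ≡⟨ cong (cost (indeg G w)) count-qt ⟩
    costAt G w ∎
    where open ≤-Reasoning
  lowOld : ∀ {y} → y ∈ remove w S → indeg G′ y ≤ 3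
  lowOld m = let y∈S , y≢w = ∈-remove⁻ S m in
    subst (_≤ 3) (sym (indeg-other _ (All.lookup I.inside y∈S) y≢w)) (All.lookup lowIn y∈S)
  lowP : indeg G′ p ≤ 3
  lowP = subst (_≤ 3) (sym indeg-p) (All.lookup lowIn w∈S)
  lowQ : indeg G′ q ≤ 3
  lowQ = subst (_≤ 3) (sym indeg-q) 2≤3
  lowT : indeg G′ t ≤ 3
  lowT = subst (_≤ 3) (sym indeg-t) 2≤3

inSplitPhase : ∀ {G₀ v s s₁} → Invariant G₀ v s → Run (InSplitStep 3) (InDone 3) s s₁ → Invariant G₀ v s₁ × InDone 3 s₁
inSplitPhase I (stop done)   = I , done
inSplitPhase I (next step r) = inSplitPhase (invariant-inSplit I step) r

outSplitPhase : ∀ {G₀ v s s₂} → Invariant G₀ v s → InDone 3 s → Run (OutSplitStep 3) (OutDone 3) s s₂ →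
  Invariant G₀ v s₂ × InDone 3 s₂ × OutDone 3 s₂
outSplitPhase I lowIn (stop done)   = I , lowIn , done
outSplitPhase I lowIn (next step r) = let I′ , lowIn′ = invariant-outSplit I lowIn step in outSplitPhase I′ lowIn′ r

-- Every vertex of degree > 3 on one side has degree > 3 on both sides.  This
-- holds for symmetric digraphs and makes the first split pay for itself.
BothHigh : DiGraph → Set
BothHigh G = All (λ y → (3 < indeg G y ⊎ 3 < outdeg G y) → 3 < indeg G y × 3 < outdeg G y) (verts G)

Untouched : DiGraph → ℕ → DiGraph → Set
Untouched G₀ v G = All (λ y → y ≢ v → y ∈ verts G × indeg G y ≡ indeg G₀ y × outdeg G y ≡ outdeg G₀ y) (verts G₀)

record SplittingOutcome (G₀ : DiGraph) (v : ℕ) (G : DiGraph) : Set where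
  field
    wellFormed : WellFormed G
    potential  : Φ G ≤ Φ G₀
    bothHigh   : BothHigh G
    untouched  : Untouched G₀ v G

-- The Splitting Procedure with d = 3 does not increase Φ: the initial split
-- and every in- and out-split replace a vertex by cheaper ones.
splittingProcedure-outcome : ∀ {G₀ v G} → WellFormed G₀ → BothHigh G₀ → v ∈ verts G₀ →
  (3 < indeg G₀ v ⊎ 3 < outdeg G₀ v) → SplittingProcedure 3 G₀ v G → SplittingOutcome G₀ v G
splittingProcedure-outcome {G₀} {v} wf bothHigh v∈ high (splitting p q s₁ (G , S) fresh inRun outRun refl) = record
  { wellFormed = I.wellFormed
  ; potential  = I.potential
  ; bothHigh   = All.tabulate bothHigh′
  ; untouched  = All.map forgetS I.untouched
  }
  where
  highBoth : 3 < indeg G₀ v × 3 < outdeg G₀ v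
  highBoth = All.lookup bothHigh v∈ high
  afterIn : Invariant G₀ v s₁ × InDone 3 s₁
  afterIn = inSplitPhase (invariant-split wf v∈ (proj₁ highBoth) (proj₂ highBoth) fresh) inRun
  afterOut : Invariant G₀ v (G , S) × InDone 3 (G , S) × OutDone 3 (G , S)
  afterOut = outSplitPhase (proj₁ afterIn) (proj₂ afterIn) outRun
  module I = SplitInvariant (proj₁ afterOut)
  forgetS : ∀ {y} → (y ≢ v → y ∈ verts G × y ∉ S × indeg G y ≡ indeg G₀ y × outdeg G y ≡ outdeg G₀ y) →
            (y ≢ v → y ∈ verts G × indeg G y ≡ indeg G₀ y × outdeg G y ≡ outdeg G₀ y)
  forgetS u y≢v = let y∈ , _ , in≡ , out≡ = u y≢v in y∈ , in≡ , out≡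
  -- Vertices of the replacing subgraph are low on both sides; the others keep their degrees.
  bothHigh′ : ∀ {y} → y ∈ verts G → (3 < indeg G y ⊎ 3 < outdeg G y) → 3 < indeg G y × 3 < outdeg G y
  bothHigh′ {y} y∈ highY with All.lookup I.covered y∈
  ... | inj₁ y∈S = ⊥-elim (low highY)
    where
    low : ¬ (3 < indeg G y ⊎ 3 < outdeg G y)
    low (inj₁ h) = <⇒≱ h (All.lookup (proj₁ (proj₂ afterOut)) y∈S)
    low (inj₂ h) = <⇒≱ h (All.lookup (proj₂ (proj₂ afterOut)) y∈S)
  ... | inj₂ (y∈₀ , y≢v) with All.lookup I.untouched y∈₀ y≢v
  ...   | _ , _ , in≡ , out≡ =
    Data.Product.map (subst (3 <_) (sym in≡)) (subst (3 <_) (sym out≡))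
      (All.lookup bothHigh y∈₀ (Data.Sum.map (subst (3 <_) in≡) (subst (3 <_) out≡) highY))
    where import Data.Product; import Data.Sum

KeepsIsolated : DiGraph → DiGraph → Set
KeepsIsolated G G₁ = All (λ y → indeg G y ≡ 0 → outdeg G y ≡ 0 → y ∈ verts G₁ × indeg G₁ y ≡ 0 × outdeg G₁ y ≡ 0) (verts G)

isolated-not-high : ∀ {i o} → i ≡ 0 → o ≡ 0 → ¬ (3 < i ⊎ 3 < o)
isolated-not-high refl _    (inj₁ ())
isolated-not-high _    refl (inj₂ ())

record Step1Outcome (G G₁ : DiGraph) : Set where
  field
    wellFormed    : WellFormed G₁
    potential     : Φ G₁ ≤ Φ G
    keepsIsolated : KeepsIsolated G G₁
    done          : Step1Done G₁

step1-outcome : ∀ {G G₁} → WellFormed G → BothHigh G → Run Step1 Step1Done G G₁ → Step1Outcome G G₁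
step1-outcome {G} wf bothHigh (stop done) = record
  { wellFormed = wf ; potential = ≤-refl ; keepsIsolated = All.tabulate (λ y∈ in0 out0 → y∈ , in0 , out0) ; done = done }
step1-outcome {G} {G₁} wf bothHigh (next {y = G′} (step1 v v∈ high proc) run) = record
  { wellFormed    = R.wellFormed
  ; potential     = ≤-trans R.potential P.potential
  ; keepsIsolated = All.map isolated P.untouched
  ; done          = R.done
  }
  where
  module P = SplittingOutcome (splittingProcedure-outcome wf bothHigh v∈ high proc)
  module R = Step1Outcome (step1-outcome P.wellFormed P.bothHigh run)
  -- An isolated vertex is not the split vertex, hence untouched by this round.
  isolated : ∀ {y} → (y ≢ v → y ∈ verts G′ × indeg G′ y ≡ indeg G y × outdeg G′ y ≡ outdeg G y) →
             indeg G y ≡ 0 → outdeg G y ≡ 0 → y ∈ verts G₁ × indeg G₁ y ≡ 0 × outdeg G₁ y ≡ 0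
  isolated {y} u in0 out0 = All.lookup R.keepsIsolated y∈G′ (trans in≡ in0) (trans out≡ out0)
    where
    y≢v : y ≢ v
    y≢v refl = isolated-not-high in0 out0 high
    y∈G′ : y ∈ verts G′
    y∈G′ = proj₁ (u y≢v)
    in≡ : indeg G′ y ≡ indeg G y
    in≡ = proj₁ (proj₂ (u y≢v))
    out≡ : outdeg G′ y ≡ outdeg G y
    out≡ = proj₂ (proj₂ (u y≢v))

edgeDeg : ℕ × ℕ → ℕ → ℕ
edgeDeg e x = δ (proj₁ e) x + δ (proj₂ e) x

degE : List (ℕ × ℕ) → ℕ → ℕ
degE es x = sumBy (λ e → edgeDeg e x) es

deg≡degE : ∀ U x → deg U x ≡ degE (uedges U) x
deg≡degE U x = trans (cong₂ _+_ (count≡sumBy _ (uedges U)) (count≡sumBy _ (uedges U))) (sym (sumBy-+ _ _ (uedges U)))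

Loopless : List (ℕ × ℕ) → Set
Loopless es = All (λ e → proj₁ e ≢ proj₂ e) es

UWellFormed : UGraph → Set
UWellFormed U = Unique (uverts U) × Ends (uverts U) (uedges U) × Loopless (uedges U)

degE-fresh : ∀ {V es x} → Ends V es → x ∉ V → degE es x ≡ 0
degE-fresh {es = es} ends x∉ =
  sumBy-zero _ es (All.map (λ (m₁ , m₂) → cong₂ _+_ (δ-≢ (∈∉⇒≢ m₁ x∉)) (δ-≢ (∈∉⇒≢ m₂ x∉))) ends)

handshakeU : ∀ U → UWellFormed U → sumBy (deg U) (uverts U) ≡ length (uedges U) + length (uedges U)
handshakeU U (u , ends , _) = begin
  sumBy (deg U) V                                          ≡⟨ sumBy-cong _ _ V (λ x → cong₂ _+_ (count≡sumBy _ E) (count≡sumBy _ E)) ⟩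
  sumBy (λ x → sumBy (λ e → δ (proj₁ e) x) E + sumBy (λ e → δ (proj₂ e) x) E) V
                                                           ≡⟨ sumBy-+ _ _ V ⟩
  sumBy (λ x → sumBy (λ e → δ (proj₁ e) x) E) V + sumBy (λ x → sumBy (λ e → δ (proj₂ e) x) E) V
                                                           ≡⟨ cong₂ _+_ (handshake proj₁ V E u (All.map proj₁ ends))
                                                                        (handshake proj₂ V E u (All.map proj₂ ends)) ⟩
  length E + length E                                      ∎
  where
  open ≡-Reasoning
  V = uverts U
  E = uedges U

Incident NonIncident : ℕ → List (ℕ × ℕ) → List (ℕ × ℕ)
Incident    w es = filterᵇ (incident w) es
NonIncident w es = filterᵇ (λ e → not (incident w e)) es

∈-Incident⁻ : ∀ {w e} es → e ∈ Incident w es → e ∈ es × T (incident w e)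
∈-Incident⁻ {w} es = ∈-filter⁻ (λ e → T? (incident w e)) {xs = es}

∈-NonIncident⁻ : ∀ {w e} es → e ∈ NonIncident w es → e ∈ es × T (not (incident w e))
∈-NonIncident⁻ {w} es = ∈-filter⁻ (λ e → T? (not (incident w e))) {xs = es}

nonIncident-ends : ∀ {w} e → T (not (incident w e)) → proj₁ e ≢ w × proj₂ e ≢ w
nonIncident-ends {w} (a , b) t with a ≟ w | b ≟ w
... | yes refl | _       rewrite ≡ᵇ-refl a = ⊥-elim t
... | no a≢w   | yes refl rewrite ≡ᵇ-≢ a≢w | ≡ᵇ-refl b = ⊥-elim t
... | no a≢w   | no b≢w  = a≢w , b≢w

incident-other : ∀ {w x} e → T (incident w e) → x ≢ w → edgeDeg e x ≡ δ (other w e) x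
incident-other {w} (a , b) t x≢w with a ≟ w
... | yes refl rewrite ≡ᵇ-refl a | δ-≢ (≢-sym x≢w) = refl
... | no a≢w rewrite ≡ᵇ-≢ a≢w with ≡ᵇ⇒≡ b w t
...   | refl rewrite δ-≢ (≢-sym x≢w) = +-identityʳ _

χ-T : ∀ {b} → T b → χ b ≡ 1
χ-T {true} _ = refl

incident-self : ∀ {w} e → T (incident w e) → proj₁ e ≢ proj₂ e → edgeDeg e w ≡ 1
incident-self {w} (a , b) t a≢b with a ≟ w
... | yes refl rewrite δ-refl a | δ-≢ (≢-sym a≢b) = refl
... | no a≢w rewrite ≡ᵇ-≢ a≢w = χ-T t

incident-far-end : ∀ {w V} e → T (incident w e) → proj₁ e ∈ V × proj₂ e ∈ V → proj₁ e ≢ proj₂ e →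
  other w e ∈ V × other w e ≢ w
incident-far-end {w} (a , b) t (a∈ , b∈) a≢b with a ≟ w
... | yes refl rewrite ≡ᵇ-refl a = b∈ , ≢-sym a≢b
... | no a≢w rewrite ≡ᵇ-≢ a≢w = a∈ , a≢w

module _ (U : UGraph) (w : ℕ) where

  private
    E : List (ℕ × ℕ)
    E = uedges U

  degE-partition : ∀ x → degE E x ≡ degE (Incident w E) x + degE (NonIncident w E) x
  degE-partition x = sumBy-partition (λ e → edgeDeg e x) (incident w) E

  degE-incident : ∀ x → x ≢ w → degE (Incident w E) x ≡ sumBy (λ n → δ n x) (nbrs U w)
  degE-incident x x≢w = trans
    (sumBy-congOn _ _ (Incident w E) (All.tabulate (λ {e} m → incident-other e (proj₂ (∈-Incident⁻ E m)) x≢w)))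
    (sym (sumBy-map (λ n → δ n x) (other w) (Incident w E)))

  deg-nbrs : Loopless E → deg U w ≡ length (nbrs U w)
  deg-nbrs loopless = begin
    deg U w                                                    ≡⟨ deg≡degE U w ⟩
    degE E w                                                   ≡⟨ degE-partition w ⟩
    degE (Incident w E) w + degE (NonIncident w E) w           ≡⟨ cong₂ _+_ incidentOnce nonIncidentNever ⟩
    sumBy (λ _ → 1) (Incident w E) + 0                         ≡⟨ +-identityʳ _ ⟩
    sumBy (λ _ → 1) (Incident w E)                             ≡⟨ sym (length≡sumBy (Incident w E)) ⟩
    length (Incident w E)                                      ≡⟨ sym (length-map (other w) (Incident w E)) ⟩
    length (nbrs U w)                                          ∎
    where
    open ≡-Reasoning
    incidentOnce : degE (Incident w E) w ≡ sumBy (λ _ → 1) (Incident w E)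
    incidentOnce = sumBy-congOn _ _ (Incident w E) (All.tabulate (λ {e} m →
      let e∈ , t = ∈-Incident⁻ E m in incident-self e t (All.lookup loopless e∈)))
    nonIncidentNever : degE (NonIncident w E) w ≡ 0
    nonIncidentNever = sumBy-zero _ (NonIncident w E) (All.tabulate (λ {e} m →
      let ne₁ , ne₂ = nonIncident-ends e (proj₂ (∈-NonIncident⁻ E m)) in
      cong₂ _+_ (δ-≢ ne₁) (δ-≢ ne₂)))

  nbrs-∈ : UWellFormed U → All (λ n → n ∈ uverts U × n ≢ w) (nbrs U w)
  nbrs-∈ (_ , ends , loopless) = map⁺ (All.tabulate (λ {e} m →
    let e∈ , t = ∈-Incident⁻ E m in incident-far-end e t (All.lookup ends e∈) (All.lookup loopless e∈)))

-- The weight of an undirected graph: θ d is the number of vertices of the final cubic graph that a vertex of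
-- degree d turns into: a 4-gate has 11 vertices, ten of degree 3 and one of
-- degree 2, i.e. weight 10 + 4; a diamond has 4 vertices of degree 3.

θ : ℕ → ℕ
θ 2 = 4
θ 4 = 14
θ _ = 1

θ≥1 : ∀ d → 1 ≤ θ d
θ≥1 0 = ≤-refl
θ≥1 1 = ≤-refl
θ≥1 2 = s≤s z≤n
θ≥1 3 = ≤-refl
θ≥1 4 = s≤s z≤n
θ≥1 (suc (suc (suc (suc (suc d))))) = ≤-refl

Θ : UGraph → ℕ
Θ U = sumBy (λ x → θ (deg U x)) (uverts U)

DegreesIn : ℕ → ℕ → UGraph → Set
DegreesIn lo hi U = All (λ x → lo ≤ deg U x × deg U x ≤ hi) (uverts U)

code-injective : ∀ a b r s → r < 3 → s < 3 → 3 * a + r ≡ 3 * b + s → a ≡ b × r ≡ s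
code-injective a b r s r<3 s<3 eq = a≡b , r≡s
  where
  open ≡-Reasoning
  swapped : ∀ a r → 3 * a + r ≡ r + a * 3
  swapped = solve-∀
  r≡s : r ≡ s
  r≡s = begin
    r                ≡⟨ sym (m<n⇒m%n≡m r<3) ⟩
    r % 3            ≡⟨ sym ([m+kn]%n≡m%n r a 3) ⟩
    (r + a * 3) % 3  ≡⟨ cong (_% 3) (trans (sym (swapped a r)) (trans eq (swapped b s))) ⟩
    (s + b * 3) % 3  ≡⟨ [m+kn]%n≡m%n s b 3 ⟩
    s % 3            ≡⟨ m<n⇒m%n≡m s<3 ⟩
    s                ∎
  a≡b : a ≡ b
  a≡b = *-cancelˡ-≡ a b 3 (+-cancelʳ-≡ r (3 * a) (3 * b) (trans eq (cong (3 * b +_) (sym r≡s))))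

δ-code-same : ∀ a b r → r < 3 → δ (3 * a + r) (3 * b + r) ≡ δ a b
δ-code-same a b r r<3 with a ≟ b
... | yes refl = trans (δ-refl (3 * a + r)) (sym (δ-refl a))
... | no a≢b   = trans (δ-≢ (λ e → a≢b (proj₁ (code-injective a b r r r<3 r<3 e)))) (sym (δ-≢ a≢b))

δ-code-diff : ∀ a b r s → r < 3 → s < 3 → r ≢ s → δ (3 * a + r) (3 * b + s) ≡ 0
δ-code-diff a b r s r<3 s<3 r≢s = δ-≢ (λ e → r≢s (proj₂ (code-injective a b r s r<3 s<3 e)))

aV≡code : ∀ a → aV a ≡ 3 * a + 0
aV≡code a = sym (+-identityʳ (3 * a))

0<3 : 0 < 3
0<3 = s≤s z≤n
1<3 : 1 < 3
1<3 = s≤s (s≤s z≤n)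
2<3 : 2 < 3
2<3 = s≤s (s≤s (s≤s z≤n))

δ-aa : ∀ a b → δ (aV a) (aV b) ≡ δ a b
δ-aa a b = trans (cong₂ δ (aV≡code a) (aV≡code b)) (δ-code-same a b 0 0<3)
δ-ab : ∀ a b → δ (aV a) (bV b) ≡ 0
δ-ab a b = trans (cong (λ k → δ k (bV b)) (aV≡code a)) (δ-code-diff a b 0 1 0<3 1<3 (λ ()))
δ-ac : ∀ a b → δ (aV a) (cV b) ≡ 0
δ-ac a b = trans (cong (λ k → δ k (cV b)) (aV≡code a)) (δ-code-diff a b 0 2 0<3 2<3 (λ ()))
δ-ba : ∀ a b → δ (bV a) (aV b) ≡ 0
δ-ba a b = trans (cong (δ (bV a)) (aV≡code b)) (δ-code-diff a b 1 0 1<3 0<3 (λ ()))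
δ-bb : ∀ a b → δ (bV a) (bV b) ≡ δ a b
δ-bb a b = δ-code-same a b 1 1<3
δ-bc : ∀ a b → δ (bV a) (cV b) ≡ 0
δ-bc a b = δ-code-diff a b 1 2 1<3 2<3 (λ ())
δ-ca : ∀ a b → δ (cV a) (aV b) ≡ 0
δ-ca a b = trans (cong (δ (cV a)) (aV≡code b)) (δ-code-diff a b 2 0 2<3 0<3 (λ ()))
δ-cb : ∀ a b → δ (cV a) (bV b) ≡ 0
δ-cb a b = δ-code-diff a b 2 1 2<3 1<3 (λ ())
δ-cc : ∀ a b → δ (cV a) (cV b) ≡ δ a b
δ-cc a b = δ-code-same a b 2 2<3

δ≡0⇒≢ : ∀ {a b} → δ a b ≡ 0 → a ≢ b
δ≡0⇒≢ {a} d refl = 0≢1+n (trans (sym d) (δ-refl a))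

triple : ℕ → List ℕ
triple v = aV v ∷ bV v ∷ cV v ∷ []

∈-triple⁻ : ∀ {v x} → x ∈ triple v → ∃ λ r → r < 3 × x ≡ 3 * v + r
∈-triple⁻ {v} (here refl)                 = 0 , 0<3 , aV≡code v
∈-triple⁻     (there (here refl))         = 1 , 1<3 , refl
∈-triple⁻     (there (there (here refl))) = 2 , 2<3 , refl

triples-unique : ∀ V → Unique V → Unique (concatMap triple V)
triples-unique []       []         = []
triples-unique (v ∷ V) (v∉ ∷ u) = Unique.++⁺ tripleUnique (triples-unique V u) disjoint
  where
  tripleUnique : Unique (triple v)
  tripleUnique = (δ≡0⇒≢ (δ-ab v v) ∷ δ≡0⇒≢ (δ-ac v v) ∷ []) ∷ (δ≡0⇒≢ (δ-bc v v) ∷ []) ∷ [] ∷ []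
  disjoint : ∀ {x} → ¬ (x ∈ triple v × x ∈ concatMap triple V)
  disjoint (m , m′) with find (∈-concatMap⁻ triple {xs = V} m′)
  ... | u , u∈ , m″ =
    let r , r<3 , e = ∈-triple⁻ {v} m ; s , s<3 , e′ = ∈-triple⁻ {u} m″ in
    All.lookup v∉ u∈ (proj₁ (code-injective v u r s r<3 s<3 (trans (sym e) e′)))

-- For degrees at most 3 the cost of a vertex is the weight of its triple:
-- a_v has degree i+1, b_v degree 2 and c_v degree o+1.
cost-small : ∀ i o → i ≤ 3 → o ≤ 3 → θ (suc i) + (θ 2 + (θ (suc o) + 0)) ≡ cost i o
cost-small 0 0 _ _ = refl
cost-small 0 1 _ _ = refl
cost-small 0 2 _ _ = refl
cost-small 0 3 _ _ = refl
cost-small 1 0 _ _ = refl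
cost-small 1 1 _ _ = refl
cost-small 1 2 _ _ = refl
cost-small 1 3 _ _ = refl
cost-small 2 0 _ _ = refl
cost-small 2 1 _ _ = refl
cost-small 2 2 _ _ = refl
cost-small 2 3 _ _ = refl
cost-small 3 0 _ _ = refl
cost-small 3 1 _ _ = refl
cost-small 3 2 _ _ = refl
cost-small 3 3 _ _ = refl
cost-small (suc (suc (suc (suc i)))) o (s≤s (s≤s (s≤s ()))) _
cost-small i (suc (suc (suc (suc o)))) _ (s≤s (s≤s (s≤s ())))

module Undirected (G : DiGraph) (wf : WellFormed G) where

  private
    V : List ℕ
    V = verts G
    A : List (ℕ × ℕ)
    A = arcs G
    arcEdge : ℕ × ℕ → ℕ × ℕ
    arcEdge a = (cV (proj₁ a) , aV (proj₂ a))
    pathEdges : ℕ → List (ℕ × ℕ)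
    pathEdges v = (aV v , bV v) ∷ (bV v , cV v) ∷ []

  U₂ : UGraph
  U₂ = toUndirected G

  deg₂ : ∀ x → deg U₂ x ≡ sumBy (λ v → edgeDeg (aV v , bV v) x + (edgeDeg (bV v , cV v) x + 0)) V
                          + sumBy (λ a → edgeDeg (arcEdge a) x) A
  deg₂ x = trans (deg≡degE U₂ x) (trans (sumBy-++ _ (concatMap pathEdges V) (map arcEdge A))
             (cong₂ _+_ (sumBy-concatMap (λ e → edgeDeg e x) pathEdges V) (sumBy-map (λ e → edgeDeg e x) arcEdge A)))

  deg-a : ∀ y → y ∈ V → deg U₂ (aV y) ≡ 1 + indeg G y
  deg-a y y∈ = trans (deg₂ (aV y)) (cong₂ _+_ (trans (sumBy-cong _ _ V path) (sumBy-δ-∈ V (proj₁ wf) y∈))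
                                              (trans (sumBy-cong _ _ A arc) (sym (indeg≡inD G y))))
    where
    path : ∀ v → edgeDeg (aV v , bV v) (aV y) + (edgeDeg (bV v , cV v) (aV y) + 0) ≡ δ v y
    path v rewrite δ-aa v y | δ-ba v y | δ-ca v y = trans (+-identityʳ (δ v y + 0)) (+-identityʳ (δ v y))
    arc : ∀ a → edgeDeg (arcEdge a) (aV y) ≡ δ (proj₂ a) y
    arc a rewrite δ-ca (proj₁ a) y | δ-aa (proj₂ a) y = refl

  deg-b : ∀ y → y ∈ V → deg U₂ (bV y) ≡ 2
  deg-b y y∈ = trans (deg₂ (bV y)) (cong₂ _+_
    (trans (sumBy-cong _ _ V path) (trans (sumBy-+ _ _ V) (cong₂ _+_ (sumBy-δ-∈ V (proj₁ wf) y∈) (sumBy-δ-∈ V (proj₁ wf) y∈))))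
    (sumBy-zero _ A (All.universal arc A)))
    where
    path : ∀ v → edgeDeg (aV v , bV v) (bV y) + (edgeDeg (bV v , cV v) (bV y) + 0) ≡ δ v y + δ v y
    path v rewrite δ-ab v y | δ-bb v y | δ-cb v y = cong (δ v y +_) (trans (+-identityʳ (δ v y + 0)) (+-identityʳ (δ v y)))
    arc : ∀ a → edgeDeg (arcEdge a) (bV y) ≡ 0
    arc a rewrite δ-cb (proj₁ a) y | δ-ab (proj₂ a) y = refl

  deg-c : ∀ y → y ∈ V → deg U₂ (cV y) ≡ 1 + outdeg G y
  deg-c y y∈ = trans (deg₂ (cV y)) (cong₂ _+_ (trans (sumBy-cong _ _ V path) (sumBy-δ-∈ V (proj₁ wf) y∈))
                                              (trans (sumBy-cong _ _ A arc) (sym (outdeg≡outD G y))))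
    where
    path : ∀ v → edgeDeg (aV v , bV v) (cV y) + (edgeDeg (bV v , cV v) (cV y) + 0) ≡ δ v y
    path v rewrite δ-ac v y | δ-bc v y | δ-cc v y = +-identityʳ _
    arc : ∀ a → edgeDeg (arcEdge a) (cV y) ≡ δ (proj₁ a) y
    arc a rewrite δ-cc (proj₁ a) y | δ-ac (proj₂ a) y = +-identityʳ _

  triple-∈ : ∀ {y} → y ∈ V → aV y ∈ uverts U₂ × bV y ∈ uverts U₂ × cV y ∈ uverts U₂
  triple-∈ {y} y∈ = member (here refl) , member (there (here refl)) , member (there (there (here refl)))
    where
    member : ∀ {x} → x ∈ triple y → x ∈ uverts U₂
    member m = ∈-concatMap⁺ triple {xs = V} (Any.map (λ { refl → m }) y∈)

  wellFormed₂ : UWellFormed U₂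
  wellFormed₂ =
    triples-unique V (proj₁ wf) ,
    ++⁺ (concat⁺ (map⁺ (All.tabulate pathEnds)))
        (map⁺ (All.map (λ (m₁ , m₂) → proj₂ (proj₂ (triple-∈ m₁)) , proj₁ (triple-∈ m₂)) (proj₂ wf))) ,
    ++⁺ (concat⁺ (map⁺ (All.universal (λ v → δ≡0⇒≢ (δ-ab v v) ∷ δ≡0⇒≢ (δ-bc v v) ∷ []) V)))
        (map⁺ (All.universal (λ a → δ≡0⇒≢ (δ-ca (proj₁ a) (proj₂ a))) A))
    where
    pathEnds : ∀ {v} → v ∈ V → Ends (uverts U₂) (pathEdges v)
    pathEnds v∈ = let a∈ , b∈ , c∈ = triple-∈ v∈ in (a∈ , b∈) ∷ (b∈ , c∈) ∷ []

  degrees₂ : Step1Done G → DegreesIn 1 4 U₂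
  degrees₂ low = All.tabulate inRange
    where
    inRange : ∀ {x} → x ∈ uverts U₂ → 1 ≤ deg U₂ x × deg U₂ x ≤ 4
    inRange m with find (∈-concatMap⁻ triple {xs = V} m)
    ... | y , y∈ , here refl                 rewrite deg-a y y∈ = s≤s z≤n , s≤s (proj₁ (All.lookup low y∈))
    ... | y , y∈ , there (here refl)         rewrite deg-b y y∈ = s≤s z≤n , s≤s (s≤s z≤n)
    ... | y , y∈ , there (there (here refl)) rewrite deg-c y y∈ = s≤s z≤n , s≤s (proj₂ (All.lookup low y∈))

  Θ≡Φ : Step1Done G → Θ U₂ ≡ Φ G
  Θ≡Φ low = trans (sumBy-concatMap (λ x → θ (deg U₂ x)) triple V) (sumBy-congOn _ _ V (All.tabulate tripleWeight))
    where
    tripleWeight : ∀ {y} → y ∈ V → θ (deg U₂ (aV y)) + (θ (deg U₂ (bV y)) + (θ (deg U₂ (cV y)) + 0)) ≡ costAt G y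
    tripleWeight {y} y∈ rewrite deg-a y y∈ | deg-b y y∈ | deg-c y y∈ =
      cost-small (indeg G y) (outdeg G y) (proj₁ (All.lookup low y∈)) (proj₂ (All.lookup low y∈))

replaceU : UGraph → ℕ → List ℕ → List (ℕ × ℕ) → UGraph
replaceU U w N new = mkU (replaceVertex w (uverts U) N) (nonIncident U w ++ new)

-- The hypothesis `attach` says that the new edges meet each old vertex as
-- often as the edges at w did; then the old vertices keep their degrees.
module GadgetReplacement (U : UGraph) (w : ℕ) (N : List ℕ) (new : List (ℕ × ℕ))
    (wf : UWellFormed U) (w∈ : w ∈ uverts U) (fresh : Fresh (uverts U) N)
    (newEnds : Ends (replaceVertex w (uverts U) N) new) (newLoopless : Loopless new)
    (attach : ∀ y → y ∈ uverts U → y ≢ w → degE new y ≡ sumBy (λ n → δ n y) (nbrs U w)) where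

  private
    V : List ℕ
    V = uverts U
    E : List (ℕ × ℕ)
    E = uedges U

  U′ : UGraph
  U′ = replaceU U w N new

  deg-replaced : ∀ x → deg U′ x ≡ degE (NonIncident w E) x + degE new x
  deg-replaced x = trans (deg≡degE U′ x) (sumBy-++ _ (NonIncident w E) new)

  deg-other : ∀ y → y ∈ V → y ≢ w → deg U′ y ≡ deg U y
  deg-other y y∈ y≢w = begin
    deg U′ y                                           ≡⟨ deg-replaced y ⟩
    degE (NonIncident w E) y + degE new y              ≡⟨ cong (degE (NonIncident w E) y +_) (attach y y∈ y≢w) ⟩
    degE (NonIncident w E) y + sumBy (λ n → δ n y) (nbrs U w)
                                                       ≡⟨ cong (degE (NonIncident w E) y +_) (sym (degE-incident U w y y≢w)) ⟩
    degE (NonIncident w E) y + degE (Incident w E) y   ≡⟨ +-comm (degE (NonIncident w E) y) _ ⟩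
    degE (Incident w E) y + degE (NonIncident w E) y   ≡⟨ sym (degE-partition U w y) ⟩
    degE E y                                           ≡⟨ sym (deg≡degE U y) ⟩
    deg U y                                            ∎
    where open ≡-Reasoning

  keptEdges-ends : Ends V (NonIncident w E)
  keptEdges-ends = All.tabulate (λ m → All.lookup (proj₁ (proj₂ wf)) (proj₁ (∈-NonIncident⁻ E m)))

  deg-new : ∀ x → x ∈ N → deg U′ x ≡ degE new x
  deg-new x x∈ = trans (deg-replaced x) (cong (_+ degE new x) (degE-fresh keptEdges-ends (All.lookup (proj₂ fresh) x∈)))

  wellFormed : UWellFormed U′
  wellFormed =
    replace-unique V N (proj₁ wf) fresh ,
    ++⁺ (All.tabulate keptEnds) newEnds ,
    ++⁺ (All.tabulate (λ m → All.lookup (proj₂ (proj₂ wf)) (proj₁ (∈-NonIncident⁻ E m)))) newLoopless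
    where
    keptEnds : ∀ {e} → e ∈ NonIncident w E → proj₁ e ∈ uverts U′ × proj₂ e ∈ uverts U′
    keptEnds {e} m with ∈-NonIncident⁻ E m
    ... | e∈ , t with All.lookup (proj₁ (proj₂ wf)) e∈ | nonIncident-ends e t
    ...   | m₁ , m₂ | ne₁ , ne₂ = ∈-replace-old V N m₁ ne₁ , ∈-replace-old V N m₂ ne₂

  weight : sumBy (λ x → θ (deg U′ x)) N ≤ θ (deg U w) → Θ U′ ≤ Θ U
  weight = replace-potential V N (λ x → θ (deg U x)) (λ x → θ (deg U′ x)) (proj₁ wf) w∈
             (λ y y∈ y≢w → cong θ (deg-other y y∈ y≢w))

  degreesIn : ∀ {lo hi} → DegreesIn lo hi U → All (λ x → lo ≤ deg U′ x × deg U′ x ≤ hi) N → DegreesIn lo hi U′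
  degreesIn {lo} {hi} range newRange = All.tabulate inRange
    where
    inRange : ∀ {x} → x ∈ uverts U′ → lo ≤ deg U′ x × deg U′ x ≤ hi
    inRange {x} m with ∈-replace⁻ V N m
    ... | inj₁ (x∈ , x≢w) rewrite deg-other x x∈ x≢w = All.lookup range x∈
    ... | inj₂ x∈N = All.lookup newRange x∈N

lookup-injective : ∀ {n} (g : Vec ℕ n) → Unique (toList g) → ∀ i j → lookup g i ≡ lookup g j → i ≡ j
lookup-injective (x ∷ g) _         fz     fz     _ = refl
lookup-injective (x ∷ g) (x∉ ∷ _) fz     (fs j) e = ⊥-elim (All.lookup x∉ (∈-toList⁺ (∈-lookup j g)) e)
lookup-injective (x ∷ g) (x∉ ∷ _) (fs i) fz     e = ⊥-elim (All.lookup x∉ (∈-toList⁺ (∈-lookup i g)) (sym e))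
lookup-injective (x ∷ g) (_ ∷ u)  (fs i) (fs j) e = cong fs (lookup-injective g u i j e)

δ-lookup : ∀ {n} (g : Vec ℕ n) → Unique (toList g) → ∀ j i → δ (lookup g j) (lookup g i) ≡ δ (toℕ j) (toℕ i)
δ-lookup g u j i with j Fin.≟ i
... | yes refl = trans (δ-refl (lookup g j)) (sym (δ-refl (toℕ j)))
... | no j≢i   = trans (δ-≢ (λ e → j≢i (lookup-injective g u j i e))) (sym (δ-≢ (λ e → j≢i (Fin.toℕ-injective e))))

∈-toList-lookup : ∀ {n} (g : Vec ℕ n) {x} → x ∈ toList g → ∃ λ i → x ≡ lookup g i
∈-toList-lookup (x ∷ g) (here refl) = fz , refl
∈-toList-lookup (x ∷ g) (there m)   = let i , e = ∈-toList-lookup g m in fs i , e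

sumBy-toList : ∀ {n} (h : ℕ → ℕ) (g : Vec ℕ n) → sumBy h (toList g) ≡ sumBy (λ i → h (lookup g i)) (List.allFin n)
sumBy-toList h []      = refl
sumBy-toList {suc n} h (x ∷ g) = cong (h x +_) (begin
  sumBy h (toList g)                                           ≡⟨ sumBy-toList h g ⟩
  sumBy (λ i → h (lookup g i)) (List.allFin n)                 ≡⟨ sym (sumBy-map (λ i → h (lookup (x ∷ g) i)) fs (List.allFin n)) ⟩
  sumBy (λ i → h (lookup (x ∷ g) i)) (map fs (List.allFin n))  ≡⟨ cong (sumBy (λ i → h (lookup (x ∷ g) i))) (map-tabulate {n = n} (λ i → i) fs) ⟩
  sumBy (λ i → h (lookup (x ∷ g) i)) (List.tabulate fs)        ∎)
  where open ≡-Reasoning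

gateDeg : Fin 11 → ℕ
gateDeg i = if toℕ i ≡ᵇ 5 then 2 else 3

gateDeg-indices : ∀ i →
  sumBy (λ e → δ (toℕ (proj₁ e)) (toℕ i) + δ (toℕ (proj₂ e)) (toℕ i)) gateEdgeIdx
    + (δ 0 (toℕ i) + (δ 1 (toℕ i) + (δ 8 (toℕ i) + (δ 10 (toℕ i) + 0)))) ≡ gateDeg i
gateDeg-indices fz = refl
gateDeg-indices (fs fz) = refl
gateDeg-indices (fs (fs fz)) = refl
gateDeg-indices (fs (fs (fs fz))) = refl
gateDeg-indices (fs (fs (fs (fs fz)))) = refl
gateDeg-indices (fs (fs (fs (fs (fs fz))))) = refl
gateDeg-indices (fs (fs (fs (fs (fs (fs fz)))))) = refl
gateDeg-indices (fs (fs (fs (fs (fs (fs (fs fz))))))) = refl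
gateDeg-indices (fs (fs (fs (fs (fs (fs (fs (fs fz)))))))) = refl
gateDeg-indices (fs (fs (fs (fs (fs (fs (fs (fs (fs fz))))))))) = refl
gateDeg-indices (fs (fs (fs (fs (fs (fs (fs (fs (fs (fs fz)))))))))) = refl

gateDeg-range : ∀ i → 1 ≤ gateDeg i × gateDeg i ≤ 4
gateDeg-range i with toℕ i ≡ᵇ 5
... | true  = s≤s z≤n , s≤s (s≤s z≤n)
... | false = s≤s z≤n , s≤s (s≤s (s≤s z≤n))

gateEdgeIdx-loopless : All (λ e → proj₁ e ≢ proj₂ e) gateEdgeIdx
gateEdgeIdx-loopless = (λ ()) ∷ (λ ()) ∷ (λ ()) ∷ (λ ()) ∷ (λ ()) ∷ (λ ()) ∷ (λ ()) ∷ (λ ()) ∷ (λ ()) ∷ (λ ()) ∷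
                       (λ ()) ∷ (λ ()) ∷ (λ ()) ∷ (λ ()) ∷ []

module GateReplacement (U : UGraph) (w : ℕ) (g : Vec ℕ 11) (σ : List ℕ) (wf : UWellFormed U) (w∈ : w ∈ uverts U)
                (deg4 : deg U w ≡ 4) (fresh : Fresh (uverts U) (toList g)) (σ↭ : σ ↭ attachments g) where

  private
    V : List ℕ
    V = uverts U
    Nb : List ℕ
    Nb = nbrs U w
    len : length Nb ≡ length σ
    len = trans (trans (sym (deg-nbrs U w (proj₂ (proj₂ wf)))) deg4) (sym (↭-length σ↭))
    Nb∈ : All (λ n → n ∈ V × n ≢ w) Nb
    Nb∈ = nbrs-∈ U w wf
    σ∈ : All (_∈ toList g) σ
    σ∈ = All.tabulate (λ m → All.lookup attachments∈ (∈-resp-↭ σ↭ m))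
      where
      attachments∈ : All (_∈ toList g) (attachments g)
      attachments∈ = All.tabulate (λ {x} m → ∈-toList⁺ (Vec-∈ x m))
        where
        Vec-∈ : ∀ x → x ∈ attachments g → x ∈ᵥ g
        Vec-∈ _ (here refl)                 = ∈-lookup (# 0) g
        Vec-∈ _ (there (here refl))         = ∈-lookup (# 1) g
        Vec-∈ _ (there (there (here refl))) = ∈-lookup (# 8) g
        Vec-∈ _ (there (there (there (here refl)))) = ∈-lookup (# 10) g
    gateEnds : Ends (toList g) (gateEdges g)
    gateEnds = map⁺ (All.universal (λ e → ∈-toList⁺ (∈-lookup (proj₁ e) g) , ∈-toList⁺ (∈-lookup (proj₂ e) g)) gateEdgeIdx)
    g∉ : ∀ {x} → x ∈ V → x ∉ toList g
    g∉ x∈ m = All.lookup (proj₂ fresh) m x∈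

  new : List (ℕ × ℕ)
  new = gateEdges g ++ zip Nb σ

  degE-new : ∀ x → degE new x ≡ degE (gateEdges g) x + (sumBy (λ n → δ n x) Nb + sumBy (λ s → δ s x) σ)
  degE-new x = trans (sumBy-++ _ (gateEdges g) (zip Nb σ))
                     (cong (degE (gateEdges g) x +_) (sumBy-zip (λ n → δ n x) (λ s → δ s x) Nb σ len))

  -- Old vertices are reached only through the attachment edges, once per neighbour of w.
  attach : ∀ y → y ∈ V → y ≢ w → degE new y ≡ sumBy (λ n → δ n y) Nb
  attach y y∈ _ rewrite degE-new y | degE-fresh gateEnds (g∉ y∈)
                      | sumBy-δ-∉ σ (λ m → g∉ y∈ (All.lookup σ∈ m)) = +-identityʳ _

  newEnds : Ends (replaceVertex w V (toList g)) new
  newEnds = ++⁺ (All.map (λ (m₁ , m₂) → ∈-replace-new V _ m₁ , ∈-replace-new V _ m₂) gateEnds)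
                (zip-ends Nb σ Nb∈ σ∈)
    where
    zip-ends : ∀ ns ss → All (λ n → n ∈ V × n ≢ w) ns → All (_∈ toList g) ss → Ends (replaceVertex w V (toList g)) (zip ns ss)
    zip-ends []       _        _                  _          = []
    zip-ends (_ ∷ _)  []       _                  _          = []
    zip-ends (n ∷ ns) (s ∷ ss) ((n∈ , n≢w) ∷ ns∈) (s∈ ∷ ss∈) =
      (∈-replace-old V _ n∈ n≢w , ∈-replace-new V _ s∈) ∷ zip-ends ns ss ns∈ ss∈

  newLoopless : Loopless new
  newLoopless = ++⁺ (map⁺ (All.map (λ {e} ne eq → ne (lookup-injective g (proj₁ fresh) (proj₁ e) (proj₂ e) eq)) gateEdgeIdx-loopless))
                    (zip-loopless Nb σ Nb∈ σ∈)
    where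
    zip-loopless : ∀ ns ss → All (λ n → n ∈ V × n ≢ w) ns → All (_∈ toList g) ss → Loopless (zip ns ss)
    zip-loopless []       _        _                _          = []
    zip-loopless (_ ∷ _)  []       _                _          = []
    zip-loopless (n ∷ ns) (s ∷ ss) ((n∈ , _) ∷ ns∈) (s∈ ∷ ss∈) =
      (λ { refl → g∉ n∈ s∈ }) ∷ zip-loopless ns ss ns∈ ss∈

  open GadgetReplacement U w (toList g) new wf w∈ fresh newEnds newLoopless attach public

  deg-gate : ∀ i → deg U′ (lookup g i) ≡ gateDeg i
  deg-gate i = begin
    deg U′ x                                                            ≡⟨ deg-new x (∈-toList⁺ (∈-lookup i g)) ⟩
    degE new x                                                          ≡⟨ degE-new x ⟩
    degE (gateEdges g) x + (sumBy (λ n → δ n x) Nb + sumBy (λ s → δ s x) σ)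
      ≡⟨ cong (λ k → degE (gateEdges g) x + (k + sumBy (λ s → δ s x) σ)) (sumBy-δ-∉ Nb (λ m → g∉ (proj₁ (All.lookup Nb∈ m)) x∈g)) ⟩
    degE (gateEdges g) x + sumBy (λ s → δ s x) σ                        ≡⟨ cong (degE (gateEdges g) x +_) (sumBy-↭ (λ s → δ s x) σ↭) ⟩
    degE (gateEdges g) x + sumBy (λ s → δ s x) (attachments g)
      ≡⟨ cong₂ _+_ (trans (sumBy-map (λ e → edgeDeg e x) (λ e → lookup g (proj₁ e) , lookup g (proj₂ e)) gateEdgeIdx)
                          (sumBy-cong _ _ gateEdgeIdx (λ e → cong₂ _+_ (δ-lookup g u (proj₁ e) i) (δ-lookup g u (proj₂ e) i))))
                   (cong₂ _+_ (δ-lookup g u (# 0) i) (cong₂ _+_ (δ-lookup g u (# 1) i)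
                     (cong₂ _+_ (δ-lookup g u (# 8) i) (cong₂ _+_ (δ-lookup g u (# 10) i) refl)))) ⟩
    _                                                                   ≡⟨ gateDeg-indices i ⟩
    gateDeg i                                                           ∎
    where
    open ≡-Reasoning
    x : ℕ
    x = lookup g i
    x∈g : x ∈ toList g
    x∈g = ∈-toList⁺ (∈-lookup i g)
    u : Unique (toList g)
    u = proj₁ fresh

  -- A gate weighs 14 = θ 4, so the weight is preserved.
  gate-weight : Θ U′ ≤ Θ U
  gate-weight = weight (≤-reflexive (begin
    sumBy (λ x → θ (deg U′ x)) (toList g)                       ≡⟨ sumBy-toList (λ x → θ (deg U′ x)) g ⟩
    sumBy (λ i → θ (deg U′ (lookup g i))) (List.allFin 11)     ≡⟨ sumBy-cong _ _ (List.allFin 11) (λ i → cong θ (deg-gate i)) ⟩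
    sumBy (λ i → θ (gateDeg i)) (List.allFin 11)               ≡⟨ cong θ (sym deg4) ⟩
    θ (deg U w)                                                 ∎))
    where open ≡-Reasoning

  gate-degrees : DegreesIn 1 4 U → DegreesIn 1 4 U′
  gate-degrees range = degreesIn range (All.tabulate gateRange)
    where
    gateRange : ∀ {x} → x ∈ toList g → 1 ≤ deg U′ x × deg U′ x ≤ 4
    gateRange m with ∈-toList-lookup g m
    ... | i , refl rewrite deg-gate i = gateDeg-range i

Survives : UGraph → UGraph → Set
Survives U U₃ = All (λ y → deg U y ≢ 4 → y ∈ uverts U₃ × deg U₃ y ≡ deg U y) (uverts U)

record Step3Outcome (U U₃ : UGraph) : Set where
  field
    wellFormed : UWellFormed U₃
    degrees    : DegreesIn 1 4 U₃
    weight     : Θ U₃ ≤ Θ U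
    done       : Step3Done U₃
    survives   : Survives U U₃

step3-outcome : ∀ {U U₃} → UWellFormed U → DegreesIn 1 4 U → Run GateStep Step3Done U U₃ → Step3Outcome U U₃
step3-outcome wf range (stop done) = record
  { wellFormed = wf ; degrees = range ; weight = ≤-refl ; done = done ; survives = All.tabulate (λ y∈ _ → y∈ , refl) }
step3-outcome {U} {U₃} wf range (next (gate w g σ w∈ deg4 fresh σ↭) run) = record
  { wellFormed = R.wellFormed
  ; degrees    = R.degrees
  ; weight     = ≤-trans R.weight gate-weight
  ; done       = R.done
  ; survives   = All.tabulate survive
  }
  where
  open GateReplacement U w g σ wf w∈ deg4 fresh σ↭
  module R = Step3Outcome (step3-outcome wellFormed (gate-degrees range) run)
  survive : ∀ {y} → y ∈ uverts U → deg U y ≢ 4 → y ∈ uverts U₃ × deg U₃ y ≡ deg U y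
  survive {y} y∈ y≢4 = proj₁ later , trans (proj₂ later) (deg-other y y∈ y≢w)
    where
    y≢w : y ≢ w
    y≢w refl = y≢4 deg4
    later : y ∈ uverts U₃ × deg U₃ y ≡ deg U′ y
    later = All.lookup R.survives (∈-replace-old (uverts U) (toList g) y∈ y≢w)
                       (λ e → y≢4 (trans (sym (deg-other y y∈ y≢w)) e))

record FreshQuad (V : List ℕ) (x y z t : ℕ) : Set where
  field
    x≢y : x ≢ y
    x≢z : x ≢ z
    x≢t : x ≢ t
    y≢z : y ≢ z
    y≢t : y ≢ t
    z≢t : z ≢ t
    x∉  : x ∉ V
    y∉  : y ∉ V
    z∉  : z ∉ V
    t∉  : t ∉ V

freshQuad : ∀ {V x y z t} → Fresh V (x ∷ y ∷ z ∷ t ∷ []) → FreshQuad V x y z t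
freshQuad (((x≢y ∷ x≢z ∷ x≢t ∷ []) ∷ (y≢z ∷ y≢t ∷ []) ∷ (z≢t ∷ []) ∷ [] ∷ []) , (x∉ ∷ y∉ ∷ z∉ ∷ t∉ ∷ [])) =
  record { x≢y = x≢y ; x≢z = x≢z ; x≢t = x≢t ; y≢z = y≢z ; y≢t = y≢t ; z≢t = z≢t
         ; x∉ = x∉ ; y∉ = y∉ ; z∉ = z∉ ; t∉ = t∉ }

module DiamondReplacement (U : UGraph) (v u w x y z t : ℕ) (wf : UWellFormed U) (v∈ : v ∈ uverts U)
                          (deg2 : deg U v ≡ 2) (nbrs↭ : nbrs U v ↭ u ∷ w ∷ []) (fresh : Fresh (uverts U) (x ∷ y ∷ z ∷ t ∷ [])) where

  open FreshQuad (freshQuad fresh)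

  private
    V : List ℕ
    V = uverts U
    N : List ℕ
    N = x ∷ y ∷ z ∷ t ∷ []
    u∈ : u ∈ V × u ≢ v
    u∈ = All.lookup (nbrs-∈ U v wf) (∈-resp-↭ (↭-sym nbrs↭) (here refl))
    w∈ : w ∈ V × w ≢ v
    w∈ = All.lookup (nbrs-∈ U v wf) (∈-resp-↭ (↭-sym nbrs↭) (there (here refl)))
    u≢ : ∀ {n} → n ∉ V → u ≢ n
    u≢ = ∈∉⇒≢ (proj₁ u∈)
    w≢ : ∀ {n} → n ∉ V → w ≢ n
    w≢ = ∈∉⇒≢ (proj₁ w∈)

  new : List (ℕ × ℕ)
  new = (x , y) ∷ (x , z) ∷ (y , z) ∷ (y , t) ∷ (z , t) ∷ (u , x) ∷ (t , w) ∷ []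

  attach : ∀ q → q ∈ V → q ≢ v → degE new q ≡ sumBy (λ n → δ n q) (nbrs U v)
  attach q q∈ _ rewrite δ-≢ (≢-sym (∈∉⇒≢ q∈ x∉)) | δ-≢ (≢-sym (∈∉⇒≢ q∈ y∉))
                      | δ-≢ (≢-sym (∈∉⇒≢ q∈ z∉)) | δ-≢ (≢-sym (∈∉⇒≢ q∈ t∉)) =
    trans (cong (_+ (δ w q + 0)) (+-identityʳ (δ u q))) (sumBy-↭ (λ n → δ n q) (↭-sym nbrs↭))

  newEnds : Ends (replaceVertex v V N) new
  newEnds = (x∈ , y∈) ∷ (x∈ , z∈) ∷ (y∈ , z∈) ∷ (y∈ , t∈) ∷ (z∈ , t∈) ∷
            (∈-replace-old V N (proj₁ u∈) (proj₂ u∈) , x∈) ∷ (t∈ , ∈-replace-old V N (proj₁ w∈) (proj₂ w∈)) ∷ []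
    where
    x∈ : x ∈ replaceVertex v V N
    x∈ = ∈-replace-new V N (here refl)
    y∈ : y ∈ replaceVertex v V N
    y∈ = ∈-replace-new V N (there (here refl))
    z∈ : z ∈ replaceVertex v V N
    z∈ = ∈-replace-new V N (there (there (here refl)))
    t∈ : t ∈ replaceVertex v V N
    t∈ = ∈-replace-new V N (there (there (there (here refl))))

  newLoopless : Loopless new
  newLoopless = x≢y ∷ x≢z ∷ y≢z ∷ y≢t ∷ z≢t ∷ u≢ x∉ ∷ ≢-sym (w≢ t∉) ∷ []

  open GadgetReplacement U v N new wf v∈ fresh newEnds newLoopless attach public

  deg-diamond : All (λ n → deg U′ n ≡ 3) N
  deg-diamond = trans (deg-new x (here refl)) deg-x ∷ trans (deg-new y (there (here refl))) deg-y ∷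
                trans (deg-new z (there (there (here refl)))) deg-z ∷ trans (deg-new t (there (there (there (here refl))))) deg-t ∷ []
    where
    deg-x : degE new x ≡ 3
    deg-x rewrite δ-refl x | δ-≢ (≢-sym x≢y) | δ-≢ (≢-sym x≢z) | δ-≢ (≢-sym x≢t) | δ-≢ (u≢ x∉) | δ-≢ (w≢ x∉) = refl
    deg-y : degE new y ≡ 3
    deg-y rewrite δ-refl y | δ-≢ x≢y | δ-≢ (≢-sym y≢z) | δ-≢ (≢-sym y≢t) | δ-≢ (u≢ y∉) | δ-≢ (w≢ y∉) = refl
    deg-z : degE new z ≡ 3
    deg-z rewrite δ-refl z | δ-≢ x≢z | δ-≢ y≢z | δ-≢ (≢-sym z≢t) | δ-≢ (u≢ z∉) | δ-≢ (w≢ z∉) = refl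
    deg-t : degE new t ≡ 3
    deg-t rewrite δ-refl t | δ-≢ x≢t | δ-≢ y≢t | δ-≢ z≢t | δ-≢ (u≢ t∉) | δ-≢ (w≢ t∉) = refl

  -- A diamond weighs 4 = θ 2.
  diamond-weight : Θ U′ ≤ Θ U
  diamond-weight = weight (≤-reflexive (trans (sumBy-congOn _ (λ _ → 1) N (All.map (cong θ) deg-diamond)) (cong θ (sym deg2))))

  diamond-degrees : DegreesIn 2 3 U → DegreesIn 2 3 U′
  diamond-degrees range = degreesIn range (All.map (λ d → ≤-trans 2≤3 (≤-reflexive (sym d)) , ≤-reflexive d) deg-diamond)

record Step4Outcome (U C : UGraph) : Set where
  field
    wellFormed : UWellFormed C
    degrees    : DegreesIn 2 3 C
    weight     : Θ C ≤ Θ U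
    done       : Step4Done C

diamonds-outcome : ∀ {U C} → UWellFormed U → DegreesIn 2 3 U → Run DiamondStep Step4Done U C → Step4Outcome U C
diamonds-outcome wf range (stop done) = record { wellFormed = wf ; degrees = range ; weight = ≤-refl ; done = done }
diamonds-outcome {U} wf range (next (diamond v u w x y z t v∈ deg2 nbrs↭ fresh) run) = record
  { wellFormed = R.wellFormed ; degrees = R.degrees ; weight = ≤-trans R.weight diamond-weight ; done = R.done }
  where
  open DiamondReplacement U v u w x y z t wf v∈ deg2 nbrs↭ fresh
  module R = Step4Outcome (diamonds-outcome wellFormed (diamond-degrees range) run)

-- Only two consequences of simplicity are used: the vertex labels are
-- distinct and every edge joins two vertices.

module InputDigraph (Γ : UGraph) (unique : Unique (uverts Γ)) (ends : Ends (uverts Γ) (uedges Γ)) where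

  private
    V : List ℕ
    V = uverts Γ
    E : List (ℕ × ℕ)
    E = uedges Γ
    bothArcs : ℕ × ℕ → List (ℕ × ℕ)
    bothArcs e = e ∷ (proj₂ e , proj₁ e) ∷ []

  G₀ : DiGraph
  G₀ = toDigraph Γ

  wellFormed₀ : WellFormed G₀
  wellFormed₀ = unique , concat⁺ (map⁺ (All.map (λ (m₁ , m₂) → (m₁ , m₂) ∷ (m₂ , m₁) ∷ []) ends))

  -- Each edge gives one arc into and one arc out of each of its ends.
  indeg≡outdeg : ∀ y → indeg G₀ y ≡ outdeg G₀ y
  indeg≡outdeg y = begin
    indeg G₀ y                                                  ≡⟨ indeg≡inD G₀ y ⟩
    inD (concatMap bothArcs E) y                                ≡⟨ sumBy-concatMap (λ a → δ (proj₂ a) y) bothArcs E ⟩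
    sumBy (λ e → δ (proj₂ e) y + (δ (proj₁ e) y + 0)) E         ≡⟨ sumBy-cong _ _ E (λ e → x∙yz≈y∙xz (δ (proj₂ e) y) (δ (proj₁ e) y) 0) ⟩
    sumBy (λ e → δ (proj₁ e) y + (δ (proj₂ e) y + 0)) E         ≡⟨ sym (sumBy-concatMap (λ a → δ (proj₁ a) y) bothArcs E) ⟩
    outD (concatMap bothArcs E) y                               ≡⟨ sym (outdeg≡outD G₀ y) ⟩
    outdeg G₀ y                                                 ∎
    where open ≡-Reasoning

  bothHigh₀ : BothHigh G₀
  bothHigh₀ = All.universal both V
    where
    both : ∀ y → (3 < indeg G₀ y ⊎ 3 < outdeg G₀ y) → 3 < indeg G₀ y × 3 < outdeg G₀ y
    both y (inj₁ h) = h , subst (3 <_) (indeg≡outdeg y) h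
    both y (inj₂ h) = subst (3 <_) (sym (indeg≡outdeg y)) h , h

  arcs-count : length (arcs G₀) ≡ 2 * length E
  arcs-count = trans (length≡sumBy (arcs G₀)) (trans (sumBy-concatMap (λ _ → 1) bothArcs E) (sumBy-const 2 E))

  sum-indeg : sumBy (indeg G₀) V ≡ length (arcs G₀)
  sum-indeg = trans (sumBy-cong _ _ V (indeg≡inD G₀)) (handshake proj₂ V (arcs G₀) unique (All.map proj₂ (proj₂ wellFormed₀)))

  sum-outdeg : sumBy (outdeg G₀) V ≡ length (arcs G₀)
  sum-outdeg = trans (sumBy-cong _ _ V (outdeg≡outD G₀)) (handshake proj₁ V (arcs G₀) unique (All.map proj₁ (proj₂ wellFormed₀)))

  Φ-bound : All (λ y → 0 < indeg G₀ y ⊎ 0 < outdeg G₀ y) V → Φ G₀ ≤ 100 * length E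
  Φ-bound nonIsolated = begin
    Φ G₀                                                 ≤⟨ sumBy-monoOn _ _ V (All.map (λ {y} → cost-linear (indeg G₀ y) (outdeg G₀ y)) nonIsolated) ⟩
    sumBy (λ y → 25 * (indeg G₀ y + outdeg G₀ y)) V      ≡⟨ sumBy-* 25 _ V ⟩
    25 * sumBy (λ y → indeg G₀ y + outdeg G₀ y) V        ≡⟨ cong (25 *_) (sumBy-+ (indeg G₀) (outdeg G₀) V) ⟩
    25 * (sumBy (indeg G₀) V + sumBy (outdeg G₀) V)      ≡⟨ cong (25 *_) (cong₂ _+_ (trans sum-indeg arcs-count) (trans sum-outdeg arcs-count)) ⟩
    25 * (2 * length E + 2 * length E)                   ≡⟨ eq (length E) ⟩
    100 * length E                                       ∎
    where
    open ≤-Reasoning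
    eq : ∀ n → 25 * (2 * n + 2 * n) ≡ 100 * n
    eq = solve-∀

vertices≤Θ : ∀ U → length (uverts U) ≤ Θ U
vertices≤Θ U = subst (_≤ Θ U) (sym (length≡sumBy (uverts U)))
                     (sumBy-monoOn _ _ (uverts U) (All.universal (λ x → θ≥1 (deg U x)) (uverts U)))

Cubic : UGraph → Set
Cubic U = All (λ x → deg U x ≡ 3) (uverts U)

cubic-edge-bound : ∀ C k → UWellFormed C → Cubic C → length (uverts C) ≤ 2 * k → length (uedges C) ≤ 3 * k
cubic-edge-bound C k wf cubic few = *-cancelˡ-≤ 2 (begin
  2 * length (uedges C)                      ≡⟨ double (length (uedges C)) ⟩
  length (uedges C) + length (uedges C)      ≡⟨ sym (handshakeU C wf) ⟩
  sumBy (deg C) (uverts C)                   ≡⟨ sumBy-congOn _ _ (uverts C) cubic ⟩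
  sumBy (λ _ → 3) (uverts C)                 ≡⟨ sumBy-const 3 (uverts C) ⟩
  3 * length (uverts C)                      ≤⟨ *-monoʳ-≤ 3 few ⟩
  3 * (2 * k)                                ≡⟨ swap23 k ⟩
  2 * (3 * k)                                ∎)
  where
  open ≤-Reasoning
  double : ∀ n → 2 * n ≡ n + n
  double = solve-∀
  swap23 : ∀ n → 3 * (2 * n) ≡ 2 * (3 * n)
  swap23 = solve-∀

degrees-after-gates : ∀ {U} → DegreesIn 1 4 U → All (λ x → deg U x ≢ 1) (uverts U) → Step3Done U → DegreesIn 2 3 U
degrees-after-gates range no1 no4 = All.tabulate (λ m → narrow (All.lookup range m) (All.lookup no1 m) (All.lookup no4 m))
  where
  narrow : ∀ {d} → 1 ≤ d × d ≤ 4 → d ≢ 1 → d ≢ 4 → 2 ≤ d × d ≤ 3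
  narrow (lo , hi) d≢1 d≢4 = ≤∧≢⇒< lo (≢-sym d≢1) , s≤s⁻¹ (≤∧≢⇒< hi d≢4)

cubic-after-diamonds : ∀ {C} → DegreesIn 2 3 C → Step4Done C → Cubic C
cubic-after-diamonds range no2 = All.tabulate (λ m → widen (All.lookup range m) (All.lookup no2 m))
  where
  widen : ∀ {d} → 2 ≤ d × d ≤ 3 → d ≢ 2 → d ≡ 3
  widen (lo , hi) d≢2 = ≤-antisym hi (≤∧≢⇒< lo (≢-sym d≢2))

petersen-bounds : ∀ e → 1 ≤ e → length (uverts petersen) ≤ 100 * e × length (uedges petersen) ≤ 150 * e
petersen-bounds e e≥1 = ≤-trans (m≤m+n 10 90) (*-monoʳ-≤ 100 e≥1) , ≤-trans (m≤m+n 15 135) (*-monoʳ-≤ 150 e≥1)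

-- An isolated vertex y of the input would survive as a_y of degree 1 in U₃.
isolated-gives-degree-1 : ∀ {G₀ G₁ U₃} (S₁ : Step1Outcome G₀ G₁) →
  Survives (toUndirected G₁) U₃ → All (λ x → deg U₃ x ≢ 1) (uverts U₃) →
  All (λ y → 0 < indeg G₀ y ⊎ 0 < outdeg G₀ y) (verts G₀)
isolated-gives-degree-1 {G₀} {G₁} {U₃} S₁ survives no1 = All.tabulate nonIsolated
  where
  open Step1Outcome S₁
  open Undirected G₁ wellFormed
  nonIsolated : ∀ {y} → y ∈ verts G₀ → 0 < indeg G₀ y ⊎ 0 < outdeg G₀ y
  nonIsolated {y} y∈ with indeg G₀ y ≟ 0 | outdeg G₀ y ≟ 0
  ... | no in≢0 | _         = inj₁ (n≢0⇒n>0 in≢0)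
  ... | yes _   | no out≢0  = inj₂ (n≢0⇒n>0 out≢0)
  ... | yes in0 | yes out0  = ⊥-elim (All.lookup no1 (proj₁ a∈U₃) (trans (proj₂ a∈U₃) deg1))
    where
    isolated : y ∈ verts G₁ × indeg G₁ y ≡ 0 × outdeg G₁ y ≡ 0
    isolated = All.lookup keepsIsolated y∈ in0 out0
    deg1 : deg U₂ (aV y) ≡ 1
    deg1 = trans (deg-a y (proj₁ isolated)) (cong suc (proj₁ (proj₂ isolated)))
    a∈U₃ : aV y ∈ uverts U₃ × deg U₃ (aV y) ≡ deg U₂ (aV y)
    a∈U₃ = All.lookup survives (proj₁ (triple-∈ (proj₁ isolated))) (λ d4 → 1≢4 (trans (sym deg1) d4))
      where
      1≢4 : 1 ≢ 4
      1≢4 ()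

corollary5p5 : (Γ : UGraph) → IsSimple Γ → 1 ≤ length (uedges Γ) →
    (C : UGraph) → QuickConversion Γ C →
    length (uverts C) ≤ 100 * length (uedges Γ) ×
    length (uedges C) ≤ 150 * length (uedges Γ)
corollary5p5 Γ _      e≥1 C (conv G₁ U₃ run₁ run₃ (toPetersen _ _ _)) = petersen-bounds (length (uedges Γ)) e≥1
corollary5p5 Γ simple e≥1 C (conv G₁ U₃ run₁ run₃ (toDiamonds no1 run₄)) =
  vertexBound , subst (length (uedges C) ≤_) (sym (*-assoc 3 50 e)) (cubic-edge-bound C (50 * e) S₄.wellFormed cubic
                  (subst (length (uverts C) ≤_) (*-assoc 2 50 e) vertexBound))
  where
  e : ℕ
  e = length (uedges Γ)
  open InputDigraph Γ (proj₁ simple) (All.map (λ (m₁ , m₂ , _) → m₁ , m₂) (proj₁ (proj₂ simple)))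
  S₁ : Step1Outcome G₀ G₁
  S₁ = step1-outcome wellFormed₀ bothHigh₀ run₁
  module S₁ = Step1Outcome S₁
  open Undirected G₁ S₁.wellFormed
  module S₃ = Step3Outcome (step3-outcome wellFormed₂ (degrees₂ S₁.done) run₃)
  module S₄ = Step4Outcome (diamonds-outcome S₃.wellFormed (degrees-after-gates {U₃} S₃.degrees no1 S₃.done) run₄)
  cubic : Cubic C
  cubic = cubic-after-diamonds {C} S₄.degrees S₄.done
  vertexBound : length (uverts C) ≤ 100 * e
  vertexBound = begin
    length (uverts C)  ≤⟨ vertices≤Θ C ⟩
    Θ C                ≤⟨ S₄.weight ⟩
    Θ U₃               ≤⟨ S₃.weight ⟩
    Θ U₂               ≡⟨ Θ≡Φ S₁.done ⟩
    Φ G₁               ≤⟨ S₁.potential ⟩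
    Φ G₀               ≤⟨ Φ-bound (isolated-gives-degree-1 {U₃ = U₃} S₁ S₃.survives no1) ⟩
    100 * e            ∎
    where open ≤-Reasoning
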